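{- Let $d_1 \mid d_2 \mid \cdots \mid d_n$ be positive integers with $d_1 \ge 2$, and let $r \ge 0$ be an integer. Then there exists a graph $\Gamma$ whose RA matrix $C_\Gamma$ has exactly $r$ elementary divisors equal to $0$ (equivalently, the right kernel of $C_\Gamma$ over $\mathbb{Q}$ has dimension $r$) and whose nonzero elementary divisors different from $1$ are precisely $d_1, \dots, d_n$.
   Context: All graphs are finite and simple. For a vertex $v$ of a graph $\Gamma$, $N[v]$ denotes the closed neighbourhood ($v$ together with its neighbours). If $\Gamma$ has vertices $v_1,\dots,v_m$, then for a set $S$ of vertices, $\vec S\in\mathbb{Z}^m$ is its $0/1$ indicator vector. The RA matrix $C_\Gamma$ is the integer matrix with $m$ columns (one per vertex) whose rows are the vectors $\vec{N[v]}$ for all vertices $v$ together with the vectors $\overrightarrow{N[u]\cap N[v]}$ for all pairs of vertices $u,v$. The elementary divisors of $C_\Gamma$ are the $m$ diagonal entries $d_1\mid d_2\mid\cdots\mid d_m$ of its Smith normal form (some possibly $0$). -}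

module Defs where

open import Data.Nat as ℕ using (ℕ; zero; suc)
open import Data.Nat.Divisibility using (_∣_)
open import Data.Integer as ℤ using (ℤ; +_)
open import Data.Fin using (Fin; zero; suc; toℕ; splitAt; remQuot; inject₁; _≟_)
open import Data.Bool using (Bool; true; false; _∨_; _∧_; if_then_else_)
open import Data.Sum using (_⊎_; inj₁; inj₂)
open import Data.Product using (Σ; _×_; _,_)
open import Data.List using (List; []; _∷_; filterᵇ; length)
open import Data.Vec.Functional using (toList)
open import Relation.Binary.PropositionalEquality using (_≡_)
open import Relation.Nullary.Decidable using (⌊_⌋)

record Graph (m : ℕ) : Set where
  field
    adj   : Fin m → Fin m → Bool
    sym   : ∀ u v → adj u v ≡ adj v u
    irrefl : ∀ v → adj v v ≡ false
open Graph public

closedNbhd : ∀ {m} → Graph m → Fin m → Fin m → Bool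
closedNbhd G v w = ⌊ v ≟ w ⌋ ∨ adj G v w

bool→ℤ : Bool → ℤ
bool→ℤ true  = + 1
bool→ℤ false = + 0

Mat : ℕ → ℕ → Set
Mat a b = Fin a → Fin b → ℤ

sumℤ : ∀ {n} → (Fin n → ℤ) → ℤ
sumℤ {zero}  f = + 0
sumℤ {suc n} f = f zero ℤ.+ sumℤ (λ i → f (suc i))


infixl 7 _·_
_·_ : ∀ {a b c} → Mat a b → Mat b c → Mat a c
(A · B) i k = sumℤ (λ j → A i j ℤ.* B j k)

identity : ∀ {n} → Mat n n
identity i j = if ⌊ i ≟ j ⌋ then + 1 else + 0

Unimodular : ∀ {n} → Mat n n → Set
Unimodular {n} U = Σ (Mat n n) λ V → (∀ i j → (U · V) i j ≡ identity i j)
                                   × (∀ i j → (V · U) i j ≡ identity i j)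

diagRect : ∀ {a b} → (Fin b → ℕ) → Mat a b
diagRect e i j = if ⌊ toℕ i ℕ.≟ toℕ j ⌋ then + (e j) else + 0

IsSmithNormalForm : ∀ {a b} → Mat a b → (Fin b → ℕ) → Set
IsSmithNormalForm {a} {b} C e =
  (∀ (i : Fin b) (j : Fin b) → toℕ j ≡ suc (toℕ i) → e i ∣ e j)
  × Σ (Mat a a) λ P → Σ (Mat b b) λ Q →
      Unimodular P × Unimodular Q × (∀ i j → (P · C · Q) i j ≡ diagRect e i j)

-- The RA matrix: rows N[v] (v ∈ Fin m), then N[u] ∩ N[v] for all
-- (ordered) pairs (u , v) ∈ Fin m × Fin m.

RA : ∀ {m} → Graph m → Mat (m ℕ.+ m ℕ.* m) m
RA {m} G r w with splitAt m r
... | inj₁ v = bool→ℤ (closedNbhd G v w)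
... | inj₂ p with remQuot {m} m p
...   | (u , v) = bool→ℤ (closedNbhd G u w ∧ closedNbhd G v w)

isZero : ℕ → Bool
isZero zero = true
isZero (suc _) = false

isNontrivial : ℕ → Bool
isNontrivial zero = false
isNontrivial (suc zero) = false
isNontrivial (suc (suc _)) = true

numZeros : ∀ {m} → (Fin m → ℕ) → ℕ
numZeros e = length (filterᵇ isZero (toList e))

nontrivialDivisors : ∀ {m} → (Fin m → ℕ) → List ℕ
nontrivialDivisors e = filterᵇ isNontrivial (toList e)

module Submission where

-- The graph is a disjoint union of one crown graph per dᵢ (parts aᵢ(0..dᵢ+1) and
-- bᵢ(0..dᵢ+1), with aᵢ(s) ~ bᵢ(t) iff s ≠ t) and a clique {apex, twin₁, …, twinᵣ}.
-- The twins have the same closed neighbourhood as the apex, so subtracting the apex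
-- column kills their columns: these give the r zero divisors.  In a crown graph with
-- n = dᵢ + 2, any two vertices u, v satisfy
--   |N[u] ∩ N[v] ∩ Bᵢ| − |N[u] ∩ N[v] ∩ Aᵢ| ≡ 0  (mod dᵢ),
-- so after adding the other b-columns and subtracting the a-columns of the component
-- to the column of bᵢ(last), every intersection row is divisible by dᵢ in that column.
-- The closed-neighbourhood rows, corrected by a few intersection rows, become
-- (I + N_T) · diag e with N_T² = 0; a block elimination with shears and the unipotent
-- matrices I ± N then brings C_Γ to diag(1, …, 1, d₀, …, d_k, 0, …, 0).

open import Defs hiding (sym)
open import Data.Nat as ℕ using (ℕ; zero; suc; _≤_; _<_)
import Data.Nat.Properties as ℕP
open import Data.Nat.Divisibility as ℕD using (_∣_)
open import Data.Integer using (ℤ; +_; -_; 0ℤ; 1ℤ; _+_; _*_; _-_)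
import Data.Integer.Properties as ℤP
open import Data.Integer.Tactic.RingSolver using (solve-∀)
open import Data.Fin as F using (Fin; zero; suc; inject₁; toℕ; fromℕ; _↑ˡ_; _↑ʳ_; splitAt; join)
import Data.Fin.Properties as FP
open import Data.Fin.Properties using (splitAt-↑ˡ; splitAt-↑ʳ; join-splitAt)
open import Data.Sum using (_⊎_; inj₁; inj₂; [_,_]; map₁)
open import Data.Product using (Σ; _×_; _,_; proj₁; proj₂)
open import Data.Maybe using (Maybe; just; nothing)
import Data.Maybe as Maybe
open import Data.Bool using (Bool; true; false; T; _∧_; _∨_; not; if_then_else_)
open import Data.Bool.Properties using (T?)
open import Data.List as List using (List; []; _∷_; filterᵇ; length)
import Data.List.Properties as ListP
open import Data.List.Relation.Unary.All.Properties using (tabulate⁺)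
import Data.Vec.Functional as Vector
import Data.Vec.Functional.Properties as VectorP
open import Data.Vec.Functional using (toList)
open import Data.Empty using (⊥-elim)
open import Function using (_∘_)
open import Relation.Binary.PropositionalEquality hiding ([_])
open import Relation.Nullary using (yes; no; ¬_; Dec)
open import Relation.Nullary.Decidable using (⌊_⌋)
open ≡-Reasoning

-- Sums and the Kronecker delta

sumℤ-cong : ∀ {n} {f g : Fin n → ℤ} → (∀ i → f i ≡ g i) → sumℤ f ≡ sumℤ g
sumℤ-cong {zero}  h = refl
sumℤ-cong {suc n} h = cong₂ _+_ (h zero) (sumℤ-cong (h ∘ suc))

sumℤ-zero : ∀ {n} {f : Fin n → ℤ} → (∀ i → f i ≡ 0ℤ) → sumℤ f ≡ 0ℤ
sumℤ-zero {zero}  h = refl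
sumℤ-zero {suc n} h rewrite h zero | sumℤ-zero {n} (h ∘ suc) = refl

sumℤ-*0 : ∀ {n} (c : Fin n → ℤ) → sumℤ (λ t → c t * 0ℤ) ≡ 0ℤ
sumℤ-*0 c = sumℤ-zero (λ t → ℤP.*-zeroʳ (c t))

sumℤ-+ : ∀ {n} (f g : Fin n → ℤ) → sumℤ (λ i → f i + g i) ≡ sumℤ f + sumℤ g
sumℤ-+ {zero}  f g = refl
sumℤ-+ {suc n} f g rewrite sumℤ-+ (f ∘ suc) (g ∘ suc) =
  interchange (f zero) (g zero) (sumℤ (f ∘ suc)) (sumℤ (g ∘ suc))
  where interchange : ∀ a b c d → a + b + (c + d) ≡ a + c + (b + d)
        interchange = solve-∀

sumℤ-*ˡ : ∀ {n} (c : ℤ) (f : Fin n → ℤ) → sumℤ (λ i → c * f i) ≡ c * sumℤ f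
sumℤ-*ˡ {zero}  c f = sym (ℤP.*-zeroʳ c)
sumℤ-*ˡ {suc n} c f rewrite sumℤ-*ˡ c (f ∘ suc) = sym (ℤP.*-distribˡ-+ c (f zero) _)

sumℤ-*ʳ : ∀ {n} (c : ℤ) (f : Fin n → ℤ) → sumℤ (λ i → f i * c) ≡ sumℤ f * c
sumℤ-*ʳ c f = trans (sumℤ-cong (λ i → ℤP.*-comm (f i) c)) (trans (sumℤ-*ˡ c f) (ℤP.*-comm c _))

sumℤ-neg : ∀ {n} (f : Fin n → ℤ) → sumℤ (λ i → - f i) ≡ - sumℤ f
sumℤ-neg {zero}  f = refl
sumℤ-neg {suc n} f rewrite sumℤ-neg (f ∘ suc) = sym (ℤP.neg-distrib-+ (f zero) _)

sumℤ-const : ∀ n (c : ℤ) → sumℤ {n} (λ _ → c) ≡ + n * c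
sumℤ-const zero    c = refl
sumℤ-const (suc n) c rewrite sumℤ-const n c = sym (ℤP.suc-* (+ n) c)

sumℤ-swap : ∀ {m n} (f : Fin m → Fin n → ℤ) →
  sumℤ (λ i → sumℤ (λ j → f i j)) ≡ sumℤ (λ j → sumℤ (λ i → f i j))
sumℤ-swap {zero}  {n} f = sym (sumℤ-zero {n} (λ j → refl))
sumℤ-swap {suc m} {n} f = begin
  sumℤ (f zero) + sumℤ (λ i → sumℤ (f (suc i)))
    ≡⟨ cong (λ x → sumℤ (f zero) + x) (sumℤ-swap (f ∘ suc)) ⟩
  sumℤ (f zero) + sumℤ (λ j → sumℤ (λ i → f (suc i) j))
    ≡⟨ sumℤ-+ (f zero) (λ j → sumℤ (λ i → f (suc i) j)) ⟨
  sumℤ (λ j → f zero j + sumℤ (λ i → f (suc i) j)) ∎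

sumℤ-↑ : ∀ b {c} (f : Fin (b ℕ.+ c) → ℤ) →
  sumℤ f ≡ sumℤ (λ i → f (i ↑ˡ c)) + sumℤ (λ i → f (b ↑ʳ i))
sumℤ-↑ zero    f = sym (ℤP.+-identityˡ _)
sumℤ-↑ (suc b) f rewrite sumℤ-↑ b (f ∘ suc) = sym (ℤP.+-assoc (f zero) _ _)

δ : ∀ {n} → Fin n → Fin n → ℤ
δ = identity

δ-refl : ∀ {n} (i : Fin n) → δ i i ≡ 1ℤ
δ-refl i with i F.≟ i
... | yes _  = refl
... | no i≢i = ⊥-elim (i≢i refl)

δ-≢ : ∀ {n} {i j : Fin n} → i ≢ j → δ i j ≡ 0ℤ
δ-≢ {i = i} {j} i≢j with i F.≟ j
... | yes i≡j = ⊥-elim (i≢j i≡j)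
... | no _    = refl

⌊≟⌋-sym : ∀ {n} (i j : Fin n) → ⌊ i F.≟ j ⌋ ≡ ⌊ j F.≟ i ⌋
⌊≟⌋-sym i j with i F.≟ j | j F.≟ i
... | yes _   | yes _   = refl
... | no _    | no _    = refl
... | yes i≡j | no j≢i  = ⊥-elim (j≢i (sym i≡j))
... | no i≢j  | yes j≡i = ⊥-elim (i≢j (sym j≡i))

δ-sym : ∀ {n} (i j : Fin n) → δ i j ≡ δ j i
δ-sym i j = cong (if_then + 1 else + 0) (⌊≟⌋-sym i j)

δ-suc : ∀ {n} (i j : Fin n) → δ (suc i) (suc j) ≡ δ i j
δ-suc i j with i F.≟ j
... | yes refl = refl
... | no _     = refl

δ-injective : ∀ {n n′} (f : Fin n → Fin n′) → (∀ {i j} → f i ≡ f j → i ≡ j) →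
  ∀ i j → δ (f i) (f j) ≡ δ i j
δ-injective f f-inj i j with i F.≟ j
... | yes refl = δ-refl (f i)
... | no i≢j   = δ-≢ (i≢j ∘ f-inj)

δ-idempotent : ∀ {n} (i j : Fin n) → (1ℤ - δ i j) * δ i j ≡ 0ℤ
δ-idempotent i j with i F.≟ j
... | yes _ = refl
... | no _  = refl

δ-*-subst : ∀ {n} (i j : Fin n) (f : Fin n → ℤ) → δ i j * f j ≡ δ i j * f i
δ-*-subst i j f with i F.≟ j
... | yes refl = refl
... | no _     = refl

sumℤ-δˡ : ∀ {n} (i : Fin n) (f : Fin n → ℤ) → sumℤ (λ j → δ i j * f j) ≡ f i
sumℤ-δˡ {suc n} zero f = begin
  1ℤ * f zero + sumℤ (λ j → δ zero (suc j) * f (suc j))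
    ≡⟨ cong₂ _+_ (ℤP.*-identityˡ (f zero)) (sumℤ-zero {n} (λ j → refl)) ⟩
  f zero + 0ℤ ≡⟨ ℤP.+-identityʳ _ ⟩
  f zero ∎
sumℤ-δˡ {suc n} (suc i) f = begin
  0ℤ + sumℤ (λ j → δ (suc i) (suc j) * f (suc j))
    ≡⟨ ℤP.+-identityˡ _ ⟩
  sumℤ (λ j → δ (suc i) (suc j) * f (suc j))
    ≡⟨ sumℤ-cong (λ j → cong (_* f (suc j)) (δ-suc i j)) ⟩
  sumℤ (λ j → δ i j * f (suc j))
    ≡⟨ sumℤ-δˡ i (f ∘ suc) ⟩
  f (suc i) ∎

sumℤ-δʳ : ∀ {n} (i : Fin n) (f : Fin n → ℤ) → sumℤ (λ j → f j * δ j i) ≡ f i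
sumℤ-δʳ i f = trans (sumℤ-cong (λ j → trans (ℤP.*-comm (f j) _) (cong (_* f j) (δ-sym j i))))
                    (sumℤ-δˡ i f)

sumℤ-δ : ∀ {n} (i : Fin n) → sumℤ (δ i) ≡ 1ℤ
sumℤ-δ i = trans (sumℤ-cong (λ j → sym (ℤP.*-identityʳ (δ i j)))) (sumℤ-δˡ i (λ _ → 1ℤ))

sumℤ-1-δ : ∀ {n} (i : Fin n) → sumℤ (λ j → 1ℤ - δ i j) ≡ + n - 1ℤ
sumℤ-1-δ {n} i = begin
  sumℤ (λ j → 1ℤ - δ i j)               ≡⟨ sumℤ-+ (λ _ → 1ℤ) (λ j → - δ i j) ⟩
  sumℤ {n} (λ _ → 1ℤ) + sumℤ (λ j → - δ i j)
    ≡⟨ cong₂ _+_ (trans (sumℤ-const n 1ℤ) (ℤP.*-identityʳ (+ n))) (sumℤ-neg (δ i)) ⟩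
  + n - sumℤ (δ i)                       ≡⟨ cong (λ x → + n - x) (sumℤ-δ i) ⟩
  + n - 1ℤ ∎

sumℤ-δδ : ∀ {n} (i j : Fin n) → sumℤ (λ t → δ i t * δ j t) ≡ δ i j
sumℤ-δδ i j = trans (sumℤ-δˡ i (δ j)) (δ-sym j i)

sumℤ-[1-δ]δ : ∀ {n} (i j : Fin n) → sumℤ (λ t → (1ℤ - δ i t) * δ j t) ≡ 1ℤ - δ i j
sumℤ-[1-δ]δ i j = trans (sumℤ-cong (λ t → ℤP.*-comm (1ℤ - δ i t) (δ j t))) (sumℤ-δˡ j (λ t → 1ℤ - δ i t))

sumℤ-[1-δ][1-δ] : ∀ {n} (i j : Fin n) →
  sumℤ (λ t → (1ℤ - δ i t) * (1ℤ - δ j t)) ≡ (+ n - 1ℤ) - (1ℤ - δ i j)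
sumℤ-[1-δ][1-δ] {n} i j = begin
  sumℤ (λ t → (1ℤ - δ i t) * (1ℤ - δ j t))
    ≡⟨ sumℤ-cong (λ t → expand (δ i t) (δ j t)) ⟩
  sumℤ (λ t → (1ℤ - δ i t) + - ((1ℤ - δ i t) * δ j t))
    ≡⟨ sumℤ-+ (λ t → 1ℤ - δ i t) (λ t → - ((1ℤ - δ i t) * δ j t)) ⟩
  sumℤ (λ t → 1ℤ - δ i t) + sumℤ (λ t → - ((1ℤ - δ i t) * δ j t))
    ≡⟨ cong₂ _+_ (sumℤ-1-δ i) (trans (sumℤ-neg (λ t → (1ℤ - δ i t) * δ j t)) (cong -_ (sumℤ-[1-δ]δ i j))) ⟩
  (+ n - 1ℤ) - (1ℤ - δ i j) ∎
  where expand : ∀ a b → (1ℤ - a) * (1ℤ - b) ≡ (1ℤ - a) + - ((1ℤ - a) * b)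
        expand = solve-∀

sumℤ-drop : ∀ {n} (i : Fin n) (f : Fin n → ℤ) → sumℤ f ≡ sumℤ (λ j → (1ℤ - δ j i) * f j) + f i
sumℤ-drop i f = begin
  sumℤ f                                              ≡⟨ sumℤ-cong (λ j → split (f j) (δ j i)) ⟩
  sumℤ (λ j → (1ℤ - δ j i) * f j + f j * δ j i)      ≡⟨ sumℤ-+ (λ j → (1ℤ - δ j i) * f j) (λ j → f j * δ j i) ⟩
  sumℤ (λ j → (1ℤ - δ j i) * f j) + sumℤ (λ j → f j * δ j i)
    ≡⟨ cong (λ x → sumℤ (λ j → (1ℤ - δ j i) * f j) + x) (sumℤ-δʳ i f) ⟩
  sumℤ (λ j → (1ℤ - δ j i) * f j) + f i ∎
  where split : ∀ x e → x ≡ (1ℤ - e) * x + x * e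
        split = solve-∀

ι : Bool → ℤ
ι = bool→ℤ

ι-∧ : ∀ a b → ι (a ∧ b) ≡ ι a * ι b
ι-∧ true  true  = refl
ι-∧ true  false = refl
ι-∧ false b     = refl

ι-∨-false : ∀ b → ι (b ∨ false) ≡ ι b
ι-∨-false true  = refl
ι-∨-false false = refl

∧-idem : ∀ b → b ∧ b ≡ b
∧-idem true  = refl
∧-idem false = refl

≟-refl : ∀ {n} (i : Fin n) → (i F.≟ i) ≡ yes refl
≟-refl i with i F.≟ i
... | yes refl = refl
... | no i≢i   = ⊥-elim (i≢i refl)

≟-≢ : ∀ {n} {i j : Fin n} → i ≢ j → ⌊ i F.≟ j ⌋ ≡ false
≟-≢ {i = i} {j} i≢j with i F.≟ j
... | yes i≡j = ⊥-elim (i≢j i≡j)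
... | no _    = refl

ι-≟ : ∀ {n} (i j : Fin n) → ι ⌊ i F.≟ j ⌋ ≡ δ i j
ι-≟ i j with i F.≟ j
... | yes _ = refl
... | no _  = refl

ι-not-≡ᵇ : ∀ {n} (s t : Fin n) → ι (not (toℕ s ℕ.≡ᵇ toℕ t)) ≡ 1ℤ - δ s t
ι-not-≡ᵇ s t with s F.≟ t | toℕ s ℕ.≡ᵇ toℕ t in eq
... | yes refl | true  = refl
... | yes refl | false = ⊥-elim (subst T eq (ℕP.≡⇒≡ᵇ (toℕ s) (toℕ s) refl))
... | no s≢t   | true  = ⊥-elim (s≢t (FP.toℕ-injective (ℕP.≡ᵇ⇒≡ (toℕ s) (toℕ t) (subst T (sym eq) _))))
... | no _     | false = refl


-- Matrix algebra

infix 4 _≈_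
_≈_ : ∀ {a b} → Mat a b → Mat a b → Set
M ≈ N = ∀ i j → M i j ≡ N i j

infixl 6 _⊕_
_⊕_ : ∀ {a b} → Mat a b → Mat a b → Mat a b
(M ⊕ N) i j = M i j + N i j

⊖ : ∀ {a b} → Mat a b → Mat a b
⊖ M i j = - M i j

𝟘 : ∀ {a b} → Mat a b
𝟘 i j = 0ℤ

I : ∀ {n} → Mat n n
I = identity

≈-sym : ∀ {a b} {M N : Mat a b} → M ≈ N → N ≈ M
≈-sym p i j = sym (p i j)

≈-trans : ∀ {a b} {M N O : Mat a b} → M ≈ N → N ≈ O → M ≈ O
≈-trans p q i j = trans (p i j) (q i j)

·-cong : ∀ {a b c} {A A′ : Mat a b} {B B′ : Mat b c} → A ≈ A′ → B ≈ B′ → A · B ≈ A′ · B′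
·-cong p q i k = sumℤ-cong (λ j → cong₂ _*_ (p i j) (q j k))

·-congˡ : ∀ {a b c} {A A′ : Mat a b} (B : Mat b c) → A ≈ A′ → A · B ≈ A′ · B
·-congˡ B p = ·-cong {B = B} p (λ _ _ → refl)

·-congʳ : ∀ {a b c} (A : Mat a b) {B B′ : Mat b c} → B ≈ B′ → A · B ≈ A · B′
·-congʳ A q = ·-cong {A = A} (λ _ _ → refl) q

·-assoc : ∀ {a b c d} (A : Mat a b) (B : Mat b c) (C : Mat c d) → (A · B) · C ≈ A · (B · C)
·-assoc A B C i l = begin
  sumℤ (λ k → sumℤ (λ j → A i j * B j k) * C k l)
    ≡⟨ sumℤ-cong (λ k → trans (sym (sumℤ-*ʳ (C k l) (λ j → A i j * B j k)))
                              (sumℤ-cong (λ j → ℤP.*-assoc (A i j) (B j k) (C k l)))) ⟩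
  sumℤ (λ k → sumℤ (λ j → A i j * (B j k * C k l)))
    ≡⟨ sumℤ-swap (λ k j → A i j * (B j k * C k l)) ⟩
  sumℤ (λ j → sumℤ (λ k → A i j * (B j k * C k l)))
    ≡⟨ sumℤ-cong (λ j → sumℤ-*ˡ (A i j) (λ k → B j k * C k l)) ⟩
  sumℤ (λ j → A i j * sumℤ (λ k → B j k * C k l)) ∎

·-distribˡ : ∀ {a b c} (A : Mat a b) (B C : Mat b c) → A · (B ⊕ C) ≈ A · B ⊕ A · C
·-distribˡ A B C i k =
  trans (sumℤ-cong (λ j → ℤP.*-distribˡ-+ (A i j) (B j k) (C j k)))
        (sumℤ-+ (λ j → A i j * B j k) (λ j → A i j * C j k))

·-distribʳ : ∀ {a b c} (A B : Mat a b) (C : Mat b c) → (A ⊕ B) · C ≈ A · C ⊕ B · C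
·-distribʳ A B C i k =
  trans (sumℤ-cong (λ j → ℤP.*-distribʳ-+ (C j k) (A i j) (B i j)))
        (sumℤ-+ (λ j → A i j * C j k) (λ j → B i j * C j k))

·-negˡ : ∀ {a b c} (A : Mat a b) (B : Mat b c) → ⊖ A · B ≈ ⊖ (A · B)
·-negˡ A B i k = trans (sumℤ-cong (λ j → sym (ℤP.neg-distribˡ-* (A i j) (B j k))))
                       (sumℤ-neg (λ j → A i j * B j k))

·-negʳ : ∀ {a b c} (A : Mat a b) (B : Mat b c) → A · ⊖ B ≈ ⊖ (A · B)
·-negʳ A B i k = trans (sumℤ-cong (λ j → sym (ℤP.neg-distribʳ-* (A i j) (B j k))))
                       (sumℤ-neg (λ j → A i j * B j k))

·-identityˡ : ∀ {a b} (A : Mat a b) → I · A ≈ A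
·-identityˡ A i k = sumℤ-δˡ i (λ j → A j k)

·-identityʳ : ∀ {a b} (A : Mat a b) → A · I ≈ A
·-identityʳ A i k = sumℤ-δʳ k (λ j → A i j)

·-zeroˡ : ∀ {a b c} (A : Mat b c) → 𝟘 {a} {b} · A ≈ 𝟘
·-zeroˡ {b = b} A i k = sumℤ-zero {b} (λ j → refl)

·-zeroʳ : ∀ {a b c} (A : Mat a b) → A · 𝟘 {b} {c} ≈ 𝟘
·-zeroʳ A i k = sumℤ-zero (λ j → ℤP.*-zeroʳ (A i j))

Unimodular-· : ∀ {n} {U V : Mat n n} → Unimodular U → Unimodular V → Unimodular (U · V)
Unimodular-· {n} {U} {V} (U⁻¹ , UU⁻¹ , U⁻¹U) (V⁻¹ , VV⁻¹ , V⁻¹V) = V⁻¹ · U⁻¹ , right , left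
  where
  right : (U · V) · (V⁻¹ · U⁻¹) ≈ I
  right = ≈-trans (·-assoc U V (V⁻¹ · U⁻¹))
          (≈-trans (·-congʳ U (≈-sym (·-assoc V V⁻¹ U⁻¹)))
          (≈-trans (·-congʳ U (·-congˡ U⁻¹ VV⁻¹))
          (≈-trans (·-congʳ U (·-identityˡ U⁻¹)) UU⁻¹)))
  left : (V⁻¹ · U⁻¹) · (U · V) ≈ I
  left = ≈-trans (·-assoc V⁻¹ U⁻¹ (U · V))
         (≈-trans (·-congʳ V⁻¹ (≈-sym (·-assoc U⁻¹ U V)))
         (≈-trans (·-congʳ V⁻¹ (·-congˡ V U⁻¹U))
         (≈-trans (·-congʳ V⁻¹ (·-identityˡ V)) V⁻¹V)))

module _ {n} (N : Mat n n) (N²≈𝟘 : N · N ≈ 𝟘) where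

  I⊕N·I⊖N : (I ⊕ N) · (I ⊕ ⊖ N) ≈ I
  I⊕N·I⊖N i j = begin
    ((I ⊕ N) · (I ⊕ ⊖ N)) i j                      ≡⟨ ·-distribʳ I N (I ⊕ ⊖ N) i j ⟩
    (I · (I ⊕ ⊖ N)) i j + (N · (I ⊕ ⊖ N)) i j
      ≡⟨ cong₂ _+_ (·-identityˡ (I ⊕ ⊖ N) i j)
           (trans (·-distribˡ N I (⊖ N) i j)
                  (cong₂ _+_ (·-identityʳ N i j) (trans (·-negʳ N N i j) (cong -_ (N²≈𝟘 i j))))) ⟩
    (I i j + - N i j) + (N i j + - 0ℤ)              ≡⟨ cancel (I i j) (N i j) ⟩
    I i j ∎
    where cancel : ∀ a b → (a + - b) + (b + - 0ℤ) ≡ a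
          cancel = solve-∀

  I⊖N·I⊕N : (I ⊕ ⊖ N) · (I ⊕ N) ≈ I
  I⊖N·I⊕N i j = begin
    ((I ⊕ ⊖ N) · (I ⊕ N)) i j                      ≡⟨ ·-distribʳ I (⊖ N) (I ⊕ N) i j ⟩
    (I · (I ⊕ N)) i j + (⊖ N · (I ⊕ N)) i j
      ≡⟨ cong₂ _+_ (·-identityˡ (I ⊕ N) i j)
           (trans (·-negˡ N (I ⊕ N) i j)
                  (cong -_ (trans (·-distribˡ N I N i j) (cong₂ _+_ (·-identityʳ N i j) (N²≈𝟘 i j))))) ⟩
    (I i j + N i j) + - (N i j + 0ℤ)                ≡⟨ cancel (I i j) (N i j) ⟩
    I i j ∎
    where cancel : ∀ a b → (a + b) + - (b + 0ℤ) ≡ a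
          cancel = solve-∀

  Unimodular-I⊕N : Unimodular (I ⊕ N)
  Unimodular-I⊕N = I ⊕ ⊖ N , I⊕N·I⊖N , I⊖N·I⊕N

  Unimodular-I⊖N : Unimodular (I ⊕ ⊖ N)
  Unimodular-I⊖N = I ⊕ N , I⊖N·I⊕N , I⊕N·I⊖N

-- Block matrices

↑-elim : ∀ b c {P : Fin (b ℕ.+ c) → Set} → (∀ i → P (i ↑ˡ c)) → (∀ i → P (b ↑ʳ i)) → ∀ i → P i
↑-elim b c {P} left right i = subst P (join-splitAt b c i) (by-cases (splitAt b i))
  where
  by-cases : ∀ s → P (join b c s)
  by-cases (inj₁ x) = left x
  by-cases (inj₂ y) = right y

↑ˡ≢↑ʳ : ∀ b c (i : Fin b) (j : Fin c) → i ↑ˡ c ≢ b ↑ʳ j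
↑ˡ≢↑ʳ b c i j eq with trans (sym (splitAt-↑ˡ b i c)) (trans (cong (splitAt b) eq) (splitAt-↑ʳ b c j))
... | ()

module _ {b c : ℕ} where

  stack : ∀ {n} → Mat b n → Mat c n → Mat (b ℕ.+ c) n
  stack M N i k = [ (λ i′ → M i′ k) , (λ i′ → N i′ k) ] (splitAt b i)

  block : Mat b b → Mat b c → Mat c b → Mat c c → Mat (b ℕ.+ c) (b ℕ.+ c)
  block A B C D i j = [ (λ i′ → [ A i′ , B i′ ] (splitAt b j)) , (λ i′ → [ C i′ , D i′ ] (splitAt b j)) ] (splitAt b i)

  stack-↑ˡ : ∀ {n} (M : Mat b n) (N : Mat c n) i k → stack M N (i ↑ˡ c) k ≡ M i k
  stack-↑ˡ M N i k rewrite splitAt-↑ˡ b i c = refl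

  stack-↑ʳ : ∀ {n} (M : Mat b n) (N : Mat c n) i k → stack M N (b ↑ʳ i) k ≡ N i k
  stack-↑ʳ M N i k rewrite splitAt-↑ʳ b c i = refl

  stack-η : ∀ {n} (C : Mat (b ℕ.+ c) n) → C ≈ stack (λ i → C (i ↑ˡ c)) (λ i → C (b ↑ʳ i))
  stack-η C = ↑-elim b c (λ i k → sym (stack-↑ˡ (λ i → C (i ↑ˡ c)) (λ i → C (b ↑ʳ i)) i k))
                         (λ i k → sym (stack-↑ʳ (λ i → C (i ↑ˡ c)) (λ i → C (b ↑ʳ i)) i k))

  stack-cong : ∀ {n} {M M′ : Mat b n} {N N′ : Mat c n} → M ≈ M′ → N ≈ N′ → stack M N ≈ stack M′ N′
  stack-cong {M = M} {M′} {N} {N′} p q = ↑-elim b c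
    (λ i k → trans (stack-↑ˡ M N i k) (trans (p i k) (sym (stack-↑ˡ M′ N′ i k))))
    (λ i k → trans (stack-↑ʳ M N i k) (trans (q i k) (sym (stack-↑ʳ M′ N′ i k))))

  stack-· : ∀ {n l} (M : Mat b n) (N : Mat c n) (Q : Mat n l) → stack M N · Q ≈ stack (M · Q) (N · Q)
  stack-· M N Q = ↑-elim b c
    (λ i k → trans (sumℤ-cong (λ j → cong (_* Q j k) (stack-↑ˡ M N i j))) (sym (stack-↑ˡ (M · Q) (N · Q) i k)))
    (λ i k → trans (sumℤ-cong (λ j → cong (_* Q j k) (stack-↑ʳ M N i j))) (sym (stack-↑ʳ (M · Q) (N · Q) i k)))

  module _ (A : Mat b b) (B : Mat b c) (C : Mat c b) (D : Mat c c) where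

    block-↑ˡ↑ˡ : ∀ i j → block A B C D (i ↑ˡ c) (j ↑ˡ c) ≡ A i j
    block-↑ˡ↑ˡ i j rewrite splitAt-↑ˡ b i c | splitAt-↑ˡ b j c = refl

    block-↑ˡ↑ʳ : ∀ i j → block A B C D (i ↑ˡ c) (b ↑ʳ j) ≡ B i j
    block-↑ˡ↑ʳ i j rewrite splitAt-↑ˡ b i c | splitAt-↑ʳ b c j = refl

    block-↑ʳ↑ˡ : ∀ i j → block A B C D (b ↑ʳ i) (j ↑ˡ c) ≡ C i j
    block-↑ʳ↑ˡ i j rewrite splitAt-↑ʳ b c i | splitAt-↑ˡ b j c = refl

    block-↑ʳ↑ʳ : ∀ i j → block A B C D (b ↑ʳ i) (b ↑ʳ j) ≡ D i j
    block-↑ʳ↑ʳ i j rewrite splitAt-↑ʳ b c i | splitAt-↑ʳ b c j = refl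

    block-·-stack : ∀ {n} (M : Mat b n) (N : Mat c n) →
      block A B C D · stack M N ≈ stack (A · M ⊕ B · N) (C · M ⊕ D · N)
    block-·-stack M N = ↑-elim b c
      (λ i k → trans (sumℤ-↑ b (λ j → block A B C D (i ↑ˡ c) j * stack M N j k))
        (trans (cong₂ _+_ (sumℤ-cong (λ j → cong₂ _*_ (block-↑ˡ↑ˡ i j) (stack-↑ˡ M N j k)))
                          (sumℤ-cong (λ j → cong₂ _*_ (block-↑ˡ↑ʳ i j) (stack-↑ʳ M N j k))))
               (sym (stack-↑ˡ (A · M ⊕ B · N) (C · M ⊕ D · N) i k))))
      (λ i k → trans (sumℤ-↑ b (λ j → block A B C D (b ↑ʳ i) j * stack M N j k))
        (trans (cong₂ _+_ (sumℤ-cong (λ j → cong₂ _*_ (block-↑ʳ↑ˡ i j) (stack-↑ˡ M N j k)))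
                          (sumℤ-cong (λ j → cong₂ _*_ (block-↑ʳ↑ʳ i j) (stack-↑ʳ M N j k))))
               (sym (stack-↑ʳ (A · M ⊕ B · N) (C · M ⊕ D · N) i k))))

  block-· : ∀ (A A′ : Mat b b) (B B′ : Mat b c) (C C′ : Mat c b) (D D′ : Mat c c) →
    block A B C D · block A′ B′ C′ D′
      ≈ block (A · A′ ⊕ B · C′) (A · B′ ⊕ B · D′) (C · A′ ⊕ D · C′) (C · B′ ⊕ D · D′)
  block-· A A′ B B′ C C′ D D′ = ↑-elim b c
    (λ i → ↑-elim b c
      (λ j → entry (i ↑ˡ c) (j ↑ˡ c)
                   (block-↑ˡ↑ˡ A B C D i) (λ l → block-↑ˡ↑ˡ A′ B′ C′ D′ l j) (block-↑ˡ↑ʳ A B C D i)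
                   (λ l → block-↑ʳ↑ˡ A′ B′ C′ D′ l j) (block-↑ˡ↑ˡ P Q R S i j))
      (λ j → entry (i ↑ˡ c) (b ↑ʳ j)
                   (block-↑ˡ↑ˡ A B C D i) (λ l → block-↑ˡ↑ʳ A′ B′ C′ D′ l j) (block-↑ˡ↑ʳ A B C D i)
                   (λ l → block-↑ʳ↑ʳ A′ B′ C′ D′ l j) (block-↑ˡ↑ʳ P Q R S i j)))
    (λ i → ↑-elim b c
      (λ j → entry (b ↑ʳ i) (j ↑ˡ c)
                   (block-↑ʳ↑ˡ A B C D i) (λ l → block-↑ˡ↑ˡ A′ B′ C′ D′ l j) (block-↑ʳ↑ʳ A B C D i)
                   (λ l → block-↑ʳ↑ˡ A′ B′ C′ D′ l j) (block-↑ʳ↑ˡ P Q R S i j))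
      (λ j → entry (b ↑ʳ i) (b ↑ʳ j)
                   (block-↑ʳ↑ˡ A B C D i) (λ l → block-↑ˡ↑ʳ A′ B′ C′ D′ l j) (block-↑ʳ↑ʳ A B C D i)
                   (λ l → block-↑ʳ↑ʳ A′ B′ C′ D′ l j) (block-↑ʳ↑ʳ P Q R S i j)))
    where
    P = A · A′ ⊕ B · C′
    Q = A · B′ ⊕ B · D′
    R = C · A′ ⊕ D · C′
    S = C · B′ ⊕ D · D′
    entry : ∀ i j {x y : Fin b → ℤ} {z w : Fin c → ℤ} →
      (∀ l → block A B C D i (l ↑ˡ c) ≡ x l) → (∀ l → block A′ B′ C′ D′ (l ↑ˡ c) j ≡ y l) →
      (∀ l → block A B C D i (b ↑ʳ l) ≡ z l) → (∀ l → block A′ B′ C′ D′ (b ↑ʳ l) j ≡ w l) →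
      block P Q R S i j ≡ sumℤ (λ l → x l * y l) + sumℤ (λ l → z l * w l) →
      (block A B C D · block A′ B′ C′ D′) i j ≡ block P Q R S i j
    entry i j Lˡ Rˡ Lʳ Rʳ eq =
      trans (sumℤ-↑ b (λ l → block A B C D i l * block A′ B′ C′ D′ l j))
            (trans (cong₂ _+_ (sumℤ-cong (λ l → cong₂ _*_ (Lˡ l) (Rˡ l)))
                              (sumℤ-cong (λ l → cong₂ _*_ (Lʳ l) (Rʳ l)))) (sym eq))

  block-cong : ∀ {A A′ B B′ C C′ D D′} → A ≈ A′ → B ≈ B′ → C ≈ C′ → D ≈ D′ →
    block A B C D ≈ block A′ B′ C′ D′
  block-cong {A} {A′} {B} {B′} {C} {C′} {D} {D′} p q r s = ↑-elim b c
    (λ i → ↑-elim b c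
      (λ j → trans (block-↑ˡ↑ˡ A B C D i j) (trans (p i j) (sym (block-↑ˡ↑ˡ A′ B′ C′ D′ i j))))
      (λ j → trans (block-↑ˡ↑ʳ A B C D i j) (trans (q i j) (sym (block-↑ˡ↑ʳ A′ B′ C′ D′ i j)))))
    (λ i → ↑-elim b c
      (λ j → trans (block-↑ʳ↑ˡ A B C D i j) (trans (r i j) (sym (block-↑ʳ↑ˡ A′ B′ C′ D′ i j))))
      (λ j → trans (block-↑ʳ↑ʳ A B C D i j) (trans (s i j) (sym (block-↑ʳ↑ʳ A′ B′ C′ D′ i j)))))

  I≈block : I ≈ block I 𝟘 𝟘 I
  I≈block = ↑-elim b c
    (λ i → ↑-elim b c
      (λ j → trans (δ-injective (_↑ˡ c) (FP.↑ˡ-injective c _ _) i j) (sym (block-↑ˡ↑ˡ I 𝟘 𝟘 I i j)))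
      (λ j → trans (δ-≢ (↑ˡ≢↑ʳ b c i j)) (sym (block-↑ˡ↑ʳ I 𝟘 𝟘 I i j))))
    (λ i → ↑-elim b c
      (λ j → trans (δ-≢ (↑ˡ≢↑ʳ b c j i ∘ sym)) (sym (block-↑ʳ↑ˡ I 𝟘 𝟘 I i j)))
      (λ j → trans (δ-injective (b ↑ʳ_) (FP.↑ʳ-injective b _ _) i j) (sym (block-↑ʳ↑ʳ I 𝟘 𝟘 I i j))))

  block-inverse : ∀ {A A′ B B′ C C′ D D′} →
    A · A′ ⊕ B · C′ ≈ I → A · B′ ⊕ B · D′ ≈ 𝟘 → C · A′ ⊕ D · C′ ≈ 𝟘 → C · B′ ⊕ D · D′ ≈ I →
    block A B C D · block A′ B′ C′ D′ ≈ I
  block-inverse {A} {A′} {B} {B′} {C} {C′} {D} {D′} p q r s =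
    ≈-trans (block-· A A′ B B′ C C′ D D′) (≈-trans (block-cong p q r s) (≈-sym I≈block))

  Unimodular-shearʳ : (X : Mat b c) → Unimodular (block I X 𝟘 I)
  Unimodular-shearʳ X = block I (⊖ X) 𝟘 I , forward , backward
    where
    forward : block I X 𝟘 I · block I (⊖ X) 𝟘 I ≈ I
    forward = block-inverse
      (λ i j → trans (cong₂ _+_ (·-identityˡ I i j) (·-zeroʳ X i j)) (ℤP.+-identityʳ _))
      (λ i j → trans (cong₂ _+_ (·-identityˡ (⊖ X) i j) (·-identityʳ X i j)) (ℤP.+-inverseˡ (X i j)))
      (λ i j → cong₂ _+_ (·-zeroˡ I i j) (·-zeroʳ I i j))
      (λ i j → trans (cong₂ _+_ (·-zeroˡ (⊖ X) i j) (·-identityˡ I i j)) (ℤP.+-identityˡ _))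
    backward : block I (⊖ X) 𝟘 I · block I X 𝟘 I ≈ I
    backward = block-inverse
      (λ i j → trans (cong₂ _+_ (·-identityˡ I i j) (·-zeroʳ (⊖ X) i j)) (ℤP.+-identityʳ _))
      (λ i j → trans (cong₂ _+_ (·-identityˡ X i j) (·-identityʳ (⊖ X) i j)) (ℤP.+-inverseʳ (X i j)))
      (λ i j → cong₂ _+_ (·-zeroˡ I i j) (·-zeroʳ I i j))
      (λ i j → trans (cong₂ _+_ (·-zeroˡ X i j) (·-identityˡ I i j)) (ℤP.+-identityˡ _))

  Unimodular-shearˡ : (Y : Mat c b) → Unimodular (block I 𝟘 Y I)
  Unimodular-shearˡ Y = block I 𝟘 (⊖ Y) I , forward , backward
    where
    forward : block I 𝟘 Y I · block I 𝟘 (⊖ Y) I ≈ I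
    forward = block-inverse
      (λ i j → trans (cong₂ _+_ (·-identityˡ I i j) (·-zeroˡ (⊖ Y) i j)) (ℤP.+-identityʳ _))
      (λ i j → cong₂ _+_ (·-zeroʳ I i j) (·-zeroˡ I i j))
      (λ i j → trans (cong₂ _+_ (·-identityʳ Y i j) (·-identityˡ (⊖ Y) i j)) (ℤP.+-inverseʳ (Y i j)))
      (λ i j → trans (cong₂ _+_ (·-zeroʳ Y i j) (·-identityˡ I i j)) (ℤP.+-identityˡ _))
    backward : block I 𝟘 (⊖ Y) I · block I 𝟘 Y I ≈ I
    backward = block-inverse
      (λ i j → trans (cong₂ _+_ (·-identityˡ I i j) (·-zeroˡ Y i j)) (ℤP.+-identityʳ _))
      (λ i j → cong₂ _+_ (·-zeroʳ I i j) (·-zeroˡ I i j))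
      (λ i j → trans (cong₂ _+_ (·-identityʳ (⊖ Y) i j) (·-identityˡ Y i j)) (ℤP.+-inverseˡ (Y i j)))
      (λ i j → trans (cong₂ _+_ (·-zeroʳ (⊖ Y) i j) (·-identityˡ I i j)) (ℤP.+-identityˡ _))

  Unimodular-blockDiag : (U : Mat b b) → Unimodular U → Unimodular (block U 𝟘 𝟘 (I {c}))
  Unimodular-blockDiag U (U⁻¹ , UU⁻¹ , U⁻¹U) = block U⁻¹ 𝟘 𝟘 I , inverse UU⁻¹ , inverse U⁻¹U
    where
    inverse : ∀ {V W} → V · W ≈ I → block V 𝟘 𝟘 I · block W 𝟘 𝟘 I ≈ I
    inverse {V} {W} VW≈I = block-inverse
      (λ i j → trans (cong₂ _+_ (VW≈I i j) (·-zeroˡ {b = c} (𝟘 {c} {b}) i j)) (ℤP.+-identityʳ _))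
      (λ i j → cong₂ _+_ (·-zeroʳ V i j) (·-zeroˡ I i j))
      (λ i j → cong₂ _+_ (·-zeroˡ W i j) (·-zeroʳ I i j))
      (λ i j → trans (cong₂ _+_ (·-zeroˡ {b = b} (𝟘 {b} {c}) i j) (·-identityˡ I i j)) (ℤP.+-identityˡ _))

-- Diagonalisation by elimination

diag : ∀ {b} → (Fin b → ℕ) → Mat b b
diag e i j = if ⌊ toℕ i ℕ.≟ toℕ j ⌋ then + e j else + 0

diag≡δ* : ∀ {b} (e : Fin b → ℕ) i j → diag e i j ≡ δ i j * + e j
diag≡δ* e i j with toℕ i ℕ.≟ toℕ j
... | yes i≡j rewrite FP.toℕ-injective i≡j | δ-refl j = sym (ℤP.*-identityˡ _)
... | no i≢j  rewrite δ-≢ {i = i} {j} (i≢j ∘ cong toℕ) = refl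

·-diag : ∀ {a b} (Z : Mat a b) (e : Fin b → ℕ) → Z · diag e ≈ (λ p k → Z p k * + e k)
·-diag Z e p k =
  trans (sumℤ-cong (λ j → trans (cong (Z p j *_) (diag≡δ* e j k)) (reorder (Z p j) (δ j k) (+ e k))))
        (sumℤ-δʳ k (λ j → Z p j * + e k))
  where reorder : ∀ x y z → x * (y * z) ≡ (x * z) * y
        reorder = solve-∀

stack-diag-𝟘 : ∀ {b c} (e : Fin b → ℕ) → stack (diag e) (𝟘 {c}) ≈ diagRect e
stack-diag-𝟘 {b} {c} e = ↑-elim b c
  (λ i k → trans (stack-↑ˡ (diag e) 𝟘 i k) (top i k))
  (λ i k → trans (stack-↑ʳ (diag e) 𝟘 i k) (sym (bottom i k)))
  where
  top : ∀ i k → diag e i k ≡ diagRect e (i ↑ˡ c) k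
  top i k rewrite FP.toℕ-↑ˡ i c = refl
  bottom : ∀ i k → diagRect e (b ↑ʳ i) k ≡ 0ℤ
  bottom i k with toℕ (b ↑ʳ i) ℕ.≟ toℕ k
  ... | no _  = refl
  ... | yes eq = ⊥-elim (ℕP.<⇒≱ (FP.toℕ<n k)
                   (subst (b ℕ.≤_) (trans (sym (FP.toℕ-↑ʳ b i)) eq) (ℕP.m≤m+n b (toℕ i))))

-- With B · (I ⊕ NQ) = Z · diag e, the row operations are P = D · S₂ · S₁, where S₁ adds X · B
-- to A, S₂ subtracts Z (I ⊕ NT)⁻¹ times the new top rows from B, and D = (I ⊕ NT)⁻¹ ⊕ I.
diagonalisation : ∀ {b c} (C : Mat (b ℕ.+ c) b) (X : Mat b c) (NT NQ : Mat b b) (e : Fin b → ℕ) →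
  let A = λ v → C (v ↑ˡ c); B = λ p → C (b ↑ʳ p) in
  NT · NT ≈ 𝟘 → NQ · NQ ≈ 𝟘 →
  (A ⊕ X · B) · (I ⊕ NQ) ≈ (I ⊕ NT) · diag e →
  (∀ p k → Σ ℤ λ y → (B · (I ⊕ NQ)) p k ≡ y * + e k) →
  Σ (Mat (b ℕ.+ c) (b ℕ.+ c)) λ P → Σ (Mat b b) λ Q →
    Unimodular P × Unimodular Q × (∀ i j → (P · C · Q) i j ≡ diagRect e i j)
diagonalisation {b} {c} C X NT NQ e NT²≈𝟘 NQ²≈𝟘 reduced divisible =
  P , Q , Unimodular-· (Unimodular-blockDiag (I ⊕ ⊖ NT) (Unimodular-I⊖N NT NT²≈𝟘))
                       (Unimodular-· (Unimodular-shearˡ Y) (Unimodular-shearʳ X))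
    , Unimodular-I⊕N NQ NQ²≈𝟘 , PCQ≈diagRect
  where
  A = λ v → C (v ↑ˡ c)
  B = λ p → C (b ↑ʳ p)
  Q = I ⊕ NQ
  Δ = diag e
  R = (I ⊕ NT) · Δ
  Z : Mat c b
  Z p k = proj₁ (divisible p k)
  Y : Mat c b
  Y = ⊖ (Z · (I ⊕ ⊖ NT))
  S₁ = block I X 𝟘 I
  S₂ = block I 𝟘 Y I
  D = block (I ⊕ ⊖ NT) 𝟘 𝟘 I
  P = D · (S₂ · S₁)

  I⊖NT·R≈Δ : (I ⊕ ⊖ NT) · R ≈ Δ
  I⊖NT·R≈Δ = ≈-trans (≈-sym (·-assoc (I ⊕ ⊖ NT) (I ⊕ NT) Δ))
             (≈-trans (·-congˡ Δ (I⊖N·I⊕N NT NT²≈𝟘)) (·-identityˡ Δ))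

  BQ≈ZΔ : B · Q ≈ Z · Δ
  BQ≈ZΔ p k = trans (proj₂ (divisible p k)) (sym (·-diag Z e p k))

  add-X·B : S₁ · stack (A · Q) (B · Q) ≈ stack R (B · Q)
  add-X·B = ≈-trans (block-·-stack I X 𝟘 I (A · Q) (B · Q))
    (stack-cong (λ i k → trans (cong₂ _+_ (·-identityˡ (A · Q) i k) (sym (·-assoc X B Q i k)))
                               (trans (sym (·-distribʳ A (X · B) Q i k)) (reduced i k)))
                (λ i k → trans (cong₂ _+_ (·-zeroˡ (A · Q) i k) (·-identityˡ (B · Q) i k)) (ℤP.+-identityˡ _)))

  Y·R≈-ZΔ : Y · R ≈ ⊖ (Z · Δ)
  Y·R≈-ZΔ = ≈-trans (·-negˡ (Z · (I ⊕ ⊖ NT)) R)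
            (λ i k → cong -_ (trans (·-assoc Z (I ⊕ ⊖ NT) R i k) (·-congʳ Z I⊖NT·R≈Δ i k)))

  clear-bottom : S₂ · stack R (B · Q) ≈ stack R 𝟘
  clear-bottom = ≈-trans (block-·-stack I 𝟘 Y I R (B · Q))
    (stack-cong (λ i k → trans (cong₂ _+_ (·-identityˡ R i k) (·-zeroˡ (B · Q) i k)) (ℤP.+-identityʳ _))
                (λ i k → trans (cong₂ _+_ (Y·R≈-ZΔ i k) (trans (·-identityˡ (B · Q) i k) (BQ≈ZΔ i k)))
                               (ℤP.+-inverseˡ ((Z · Δ) i k))))

  normalise-top : D · stack R 𝟘 ≈ stack Δ 𝟘
  normalise-top = ≈-trans (block-·-stack (I ⊕ ⊖ NT) 𝟘 𝟘 I R 𝟘)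
    (stack-cong (λ i k → trans (cong₂ _+_ (I⊖NT·R≈Δ i k) (·-zeroˡ {b = c} (𝟘 {c} {b}) i k)) (ℤP.+-identityʳ _))
                (λ i k → cong₂ _+_ (·-zeroˡ R i k) (·-identityˡ 𝟘 i k)))

  PCQ≈diagRect : P · C · Q ≈ diagRect e
  PCQ≈diagRect =
    ≈-trans (·-assoc P C Q)
    (≈-trans (·-assoc D (S₂ · S₁) (C · Q))
    (≈-trans (·-congʳ D (·-assoc S₂ S₁ (C · Q)))
    (≈-trans (·-congʳ D (·-congʳ S₂ (·-congʳ S₁ (≈-trans (·-congˡ Q (stack-η {b} {c} C)) (stack-· {b} {c} A B Q)))))
    (≈-trans (·-congʳ D (·-congʳ S₂ add-X·B))
    (≈-trans (·-congʳ D clear-bottom)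
    (≈-trans normalise-top (stack-diag-𝟘 e)))))))

-- Indexing the vertices

dropLast : ∀ {n} → Fin (suc n) → Maybe (Fin n)
dropLast {zero}  zero    = nothing
dropLast {suc n} zero    = just zero
dropLast {suc n} (suc t) = Maybe.map suc (dropLast t)

dropLast-inject₁ : ∀ {n} (t : Fin n) → dropLast (inject₁ t) ≡ just t
dropLast-inject₁ {suc n} zero    = refl
dropLast-inject₁ {suc n} (suc t) rewrite dropLast-inject₁ t = refl

dropLast-fromℕ : ∀ n → dropLast (fromℕ n) ≡ nothing
dropLast-fromℕ zero    = refl
dropLast-fromℕ (suc n) rewrite dropLast-fromℕ n = refl

dropLast≡just : ∀ {n} (t : Fin (suc n)) {t′} → dropLast t ≡ just t′ → t ≡ inject₁ t′
dropLast≡just {suc n} zero    refl = refl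
dropLast≡just {suc n} (suc t) eq with dropLast t in eq′
dropLast≡just {suc n} (suc t) refl | just _ = cong suc (dropLast≡just t eq′)

dropLast≡nothing : ∀ {n} (t : Fin (suc n)) → dropLast t ≡ nothing → t ≡ fromℕ n
dropLast≡nothing {zero}  zero    _  = refl
dropLast≡nothing {suc n} (suc t) eq with dropLast t in eq′
dropLast≡nothing {suc n} (suc t) refl | nothing = cong suc (dropLast≡nothing t eq′)

Piece : ∀ {n} → (Fin n → ℕ) → Fin n → Set
Piece f i = Fin (suc (suc (f i))) ⊎ Fin (suc (f i))

pieceSize : ∀ {n} → (Fin n → ℕ) → Fin n → ℕ
pieceSize f i = suc (suc (f i)) ℕ.+ suc (f i)

piecesSize : ∀ n → (Fin n → ℕ) → ℕ
piecesSize zero    f = 0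
piecesSize (suc n) f = pieceSize f zero ℕ.+ piecesSize n (f ∘ suc)

fromPiece : ∀ n (f : Fin n → ℕ) (i : Fin n) → Piece f i → Fin (piecesSize n f)
fromPiece (suc n) f zero    x = join _ _ x ↑ˡ piecesSize n (f ∘ suc)
fromPiece (suc n) f (suc i) x = pieceSize f zero ↑ʳ fromPiece n (f ∘ suc) i x

toPiece : ∀ n (f : Fin n → ℕ) → Fin (piecesSize n f) → Σ (Fin n) (Piece f)
toPiece (suc n) f w with splitAt (pieceSize f zero) w
... | inj₁ x = zero , splitAt (suc (suc (f zero))) x
... | inj₂ y with toPiece n (f ∘ suc) y
...   | i , x = suc i , x

toPiece-fromPiece : ∀ n f i x → toPiece n f (fromPiece n f i x) ≡ (i , x)
toPiece-fromPiece (suc n) f zero x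
  rewrite splitAt-↑ˡ (pieceSize f zero) (join _ _ x) (piecesSize n (f ∘ suc))
        | FP.splitAt-join (suc (suc (f zero))) (suc (f zero)) x = refl
toPiece-fromPiece (suc n) f (suc i) x
  rewrite splitAt-↑ʳ (pieceSize f zero) (piecesSize n (f ∘ suc)) (fromPiece n (f ∘ suc) i x)
        | toPiece-fromPiece n (f ∘ suc) i x = refl

fromPiece-toPiece : ∀ n f w → fromPiece n f (proj₁ (toPiece n f w)) (proj₂ (toPiece n f w)) ≡ w
fromPiece-toPiece (suc n) f w with splitAt (pieceSize f zero) w in eq
... | inj₁ x = trans (cong (_↑ˡ piecesSize n (f ∘ suc)) (join-splitAt (suc (suc (f zero))) (suc (f zero)) x))
                     (FP.splitAt⁻¹-↑ˡ eq)
... | inj₂ y with toPiece n (f ∘ suc) y | fromPiece-toPiece n (f ∘ suc) y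
...   | i , x | eq′ = trans (cong (pieceSize f zero ↑ʳ_) eq′) (FP.splitAt⁻¹-↑ʳ eq)

-- Divisibility chains and the shape of the diagonal

Chain : ∀ {n} → (Fin n → ℕ) → Set
Chain {n} e = ∀ (i j : Fin n) → toℕ j ≡ suc (toℕ i) → e i ∣ e j

chain-≗ : ∀ {n} {e e′ : Fin n → ℕ} → (∀ i → e i ≡ e′ i) → Chain e′ → Chain e
chain-≗ {e = e} {e′} e≗e′ chain i j j≡1+i = subst₂ _∣_ (sym (e≗e′ i)) (sym (e≗e′ j)) (chain i j j≡1+i)

chain-replicate : ∀ n x → Chain (Vector.replicate n x)
chain-replicate n x _ _ _ = ℕD.∣-refl

chain-inject₁ : ∀ {k} (d : Fin (suc k) → ℕ) → (∀ (i : Fin k) → d (inject₁ i) ∣ d (suc i)) → Chain d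
chain-inject₁ d d∣d i zero    ()
chain-inject₁ d d∣d i (suc j) j≡1+i =
  subst (λ x → d x ∣ d (suc j)) (FP.toℕ-injective (trans (FP.toℕ-inject₁ j) (ℕP.suc-injective j≡1+i))) (d∣d j)

chain-++ : ∀ {a b} {xs : Fin a → ℕ} {ys : Fin b → ℕ} →
  Chain xs → Chain ys → (∀ i j → xs i ∣ ys j) → Chain (xs Vector.++ ys)
chain-++ {a} {b} {xs} {ys} chain-xs chain-ys xs∣ys =
  ↑-elim a b {P} (λ i → ↑-elim a b (left-left i) (left-right i)) (λ i → ↑-elim a b (right-left i) (right-right i))
  where
  zs = xs Vector.++ ys
  P : Fin (a ℕ.+ b) → Set
  P i = ∀ j → toℕ j ≡ suc (toℕ i) → zs i ∣ zs j
  left-left : ∀ i j → toℕ (j ↑ˡ b) ≡ suc (toℕ (i ↑ˡ b)) → zs (i ↑ˡ b) ∣ zs (j ↑ˡ b)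
  left-left i j eq rewrite VectorP.lookup-++ˡ xs ys i | VectorP.lookup-++ˡ xs ys j
                         | FP.toℕ-↑ˡ i b | FP.toℕ-↑ˡ j b = chain-xs i j eq
  left-right : ∀ i j → toℕ (a ↑ʳ j) ≡ suc (toℕ (i ↑ˡ b)) → zs (i ↑ˡ b) ∣ zs (a ↑ʳ j)
  left-right i j _ rewrite VectorP.lookup-++ˡ xs ys i | VectorP.lookup-++ʳ xs ys j = xs∣ys i j
  right-left : ∀ i j → toℕ (j ↑ˡ b) ≡ suc (toℕ (a ↑ʳ i)) → zs (a ↑ʳ i) ∣ zs (j ↑ˡ b)
  right-left i j eq rewrite FP.toℕ-↑ˡ j b | FP.toℕ-↑ʳ a i =
    ⊥-elim (ℕP.<-asym (FP.toℕ<n j) (subst (a ℕ.<_) (sym eq) (ℕ.s≤s (ℕP.m≤m+n a (toℕ i)))))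
  right-right : ∀ i j → toℕ (a ↑ʳ j) ≡ suc (toℕ (a ↑ʳ i)) → zs (a ↑ʳ i) ∣ zs (a ↑ʳ j)
  right-right i j eq rewrite VectorP.lookup-++ʳ xs ys i | VectorP.lookup-++ʳ xs ys j
                           | FP.toℕ-↑ʳ a i | FP.toℕ-↑ʳ a j =
    chain-ys i j (ℕP.+-cancelˡ-≡ a (toℕ j) (suc (toℕ i)) (trans eq (sym (ℕP.+-suc a (toℕ i)))))

head≤ : ∀ {k} (d : Fin (suc k) → ℕ) → (∀ i → 0 < d i) → (∀ (i : Fin k) → d (inject₁ i) ∣ d (suc i)) →
  ∀ i → d zero ≤ d i
head≤ d d>0 d∣d zero = ℕP.≤-refl
head≤ {suc k} d d>0 d∣d (suc i) =
  ℕP.≤-trans (ℕD.∣⇒≤ ⦃ ℕ.>-nonZero (d>0 (suc zero)) ⦄ (d∣d zero)) (head≤ (d ∘ suc) (d>0 ∘ suc) (d∣d ∘ suc) i)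

smithDiagonal : ∀ a {K} r → (Fin K → ℕ) → Fin (a ℕ.+ (K ℕ.+ r)) → ℕ
smithDiagonal a r d = Vector.replicate a 1 Vector.++ (d Vector.++ Vector.replicate r 0)

toList-++ : ∀ {A : Set} {a b} (xs : Fin a → A) (ys : Fin b → A) → toList (xs Vector.++ ys) ≡ toList xs List.++ toList ys
toList-++ {a = zero}  xs ys = refl
toList-++ {a = suc a} xs ys = cong (xs zero ∷_) (trans (ListP.tabulate-cong shift) (toList-++ (xs ∘ suc) ys))
  where
  shift : ∀ x → (xs Vector.++ ys) (suc x) ≡ ((xs ∘ suc) Vector.++ ys) x
  shift x with splitAt a x
  ... | inj₁ _ = refl
  ... | inj₂ _ = refl

toList-smithDiagonal : ∀ a {K} r (d : Fin K → ℕ) →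
  toList (smithDiagonal a r d) ≡ toList (Vector.replicate a 1) List.++ (toList d List.++ toList (Vector.replicate r 0))
toList-smithDiagonal a r d =
  trans (toList-++ (Vector.replicate a 1) _) (cong (toList (Vector.replicate a 1) List.++_) (toList-++ d _))

numZeros-smithDiagonal : ∀ a {K} r (d : Fin K → ℕ) → (∀ i → 0 < d i) → numZeros (smithDiagonal a r d) ≡ r
numZeros-smithDiagonal a r d d>0 = begin
  length (filterᵇ isZero (toList (smithDiagonal a r d)))
    ≡⟨ cong (length ∘ filterᵇ isZero) (toList-smithDiagonal a r d) ⟩
  length (filterᵇ isZero (ones List.++ (toList d List.++ zeros)))
    ≡⟨ cong length (trans (ListP.filter-++ P? ones _) (cong (filterᵇ isZero ones List.++_) (ListP.filter-++ P? (toList d) zeros))) ⟩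
  length (filterᵇ isZero ones List.++ (filterᵇ isZero (toList d) List.++ filterᵇ isZero zeros))
    ≡⟨ cong₂ (λ xs ys → length (xs List.++ (ys List.++ filterᵇ isZero zeros)))
             (ListP.filter-none P? (tabulate⁺ {f = Vector.replicate a 1} (λ _ ())))
             (ListP.filter-none P? (tabulate⁺ {f = d} (λ i → positive (d>0 i)))) ⟩
  length (filterᵇ isZero zeros)
    ≡⟨ cong length (ListP.filter-all P? (tabulate⁺ {f = Vector.replicate r 0} _)) ⟩
  length zeros
    ≡⟨ ListP.length-tabulate (Vector.replicate r 0) ⟩
  r ∎
  where
  ones = toList (Vector.replicate a 1)
  zeros = toList (Vector.replicate r 0)
  P? = T? ∘ isZero
  positive : ∀ {n} → 0 < n → ¬ T (isZero n)
  positive {suc n} _ ()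

nontrivialDivisors-smithDiagonal : ∀ a {K} r (d : Fin K → ℕ) → (∀ i → 2 ≤ d i) →
  nontrivialDivisors (smithDiagonal a r d) ≡ toList d
nontrivialDivisors-smithDiagonal a r d d≥2 = begin
  filterᵇ isNontrivial (toList (smithDiagonal a r d))
    ≡⟨ cong (filterᵇ isNontrivial) (toList-smithDiagonal a r d) ⟩
  filterᵇ isNontrivial (ones List.++ (toList d List.++ zeros))
    ≡⟨ trans (ListP.filter-++ P? ones _) (cong (filterᵇ isNontrivial ones List.++_) (ListP.filter-++ P? (toList d) zeros)) ⟩
  filterᵇ isNontrivial ones List.++ (filterᵇ isNontrivial (toList d) List.++ filterᵇ isNontrivial zeros)
    ≡⟨ cong₂ (λ xs ys → xs List.++ (ys List.++ filterᵇ isNontrivial zeros))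
             (ListP.filter-none P? (tabulate⁺ {f = Vector.replicate a 1} (λ _ ())))
             (ListP.filter-all P? (tabulate⁺ {f = d} (λ i → nontrivial (d≥2 i)))) ⟩
  toList d List.++ filterᵇ isNontrivial zeros
    ≡⟨ cong (toList d List.++_) (ListP.filter-none P? (tabulate⁺ {f = Vector.replicate r 0} (λ _ ()))) ⟩
  toList d List.++ []
    ≡⟨ ListP.++-identityʳ (toList d) ⟩
  toList d ∎
  where
  ones = toList (Vector.replicate a 1)
  zeros = toList (Vector.replicate r 0)
  P? = T? ∘ isNontrivial
  nontrivial : ∀ {n} → 2 ≤ n → T (isNontrivial n)
  nontrivial {suc zero}    (ℕ.s≤s ())
  nontrivial {suc (suc n)} _ = _

-- The graph

module Construction (k : ℕ) (d : Fin (suc k) → ℕ) (r : ℕ) (d>0 : ∀ i → 0 < d i) where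

  K O m : ℕ
  K = suc k
  O = piecesSize K d
  m = suc (O ℕ.+ (K ℕ.+ r))

  data Vertex : Set where
    apex : Vertex
    twin : Fin r → Vertex
    av bv : (i : Fin K) → Fin (suc (suc (d i))) → Vertex

  last : (i : Fin K) → Fin (suc (suc (d i)))
  last i = fromℕ (suc (d i))

  -- Index 0 is the apex, the next O indices are all av i s and all bv i t with t ≠ last i,
  -- then come the bv i (last i) and finally the twins, so that the Smith form is
  -- smithDiagonal (suc O) r d.
  vertexOfPiece : Σ (Fin K) (Piece d) → Vertex
  vertexOfPiece (i , inj₁ s) = av i s
  vertexOfPiece (i , inj₂ t) = bv i (inject₁ t)

  vertexOfTail : Fin K ⊎ Fin r → Vertex
  vertexOfTail (inj₁ i) = bv i (last i)
  vertexOfTail (inj₂ t) = twin t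

  vertexOfBody : Fin O ⊎ Fin (K ℕ.+ r) → Vertex
  vertexOfBody (inj₁ o) = vertexOfPiece (toPiece K d o)
  vertexOfBody (inj₂ w) = vertexOfTail (splitAt K w)

  vertex : Fin m → Vertex
  vertex zero    = apex
  vertex (suc w) = vertexOfBody (splitAt O w)

  indexOfB : (i : Fin K) → Maybe (Fin (suc (d i))) → Fin m
  indexOfB i (just t) = suc (fromPiece K d i (inj₂ t) ↑ˡ (K ℕ.+ r))
  indexOfB i nothing  = suc (O ↑ʳ (i ↑ˡ r))

  index : Vertex → Fin m
  index apex     = zero
  index (twin t) = suc (O ↑ʳ (K ↑ʳ t))
  index (av i s) = suc (fromPiece K d i (inj₁ s) ↑ˡ (K ℕ.+ r))
  index (bv i t) = indexOfB i (dropLast t)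

  vertex-index : ∀ x → vertex (index x) ≡ x
  vertex-index apex = refl
  vertex-index (twin t) rewrite splitAt-↑ʳ O (K ℕ.+ r) (K ↑ʳ t) | splitAt-↑ʳ K r t = refl
  vertex-index (av i s)
    rewrite splitAt-↑ˡ O (fromPiece K d i (inj₁ s)) (K ℕ.+ r) | toPiece-fromPiece K d i (inj₁ s) = refl
  vertex-index (bv i t) with dropLast t in eq
  ... | just t′ rewrite splitAt-↑ˡ O (fromPiece K d i (inj₂ t′)) (K ℕ.+ r) | toPiece-fromPiece K d i (inj₂ t′) =
        cong (bv i) (sym (dropLast≡just t eq))
  ... | nothing rewrite splitAt-↑ʳ O (K ℕ.+ r) (i ↑ˡ r) | splitAt-↑ˡ K i r =
        cong (bv i) (sym (dropLast≡nothing t eq))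

  index-vertex : ∀ w → index (vertex w) ≡ w
  index-vertex zero    = refl
  index-vertex (suc w) = trans (body (splitAt O w)) (cong suc (join-splitAt O (K ℕ.+ r) w))
    where
    piece : ∀ o → index (vertexOfPiece (toPiece K d o)) ≡ suc (o ↑ˡ (K ℕ.+ r))
    piece o with toPiece K d o | fromPiece-toPiece K d o
    ... | i , inj₁ s | eq = cong (λ x → suc (x ↑ˡ (K ℕ.+ r))) eq
    ... | i , inj₂ t | eq rewrite dropLast-inject₁ t = cong (λ x → suc (x ↑ˡ (K ℕ.+ r))) eq
    tail : ∀ s → index (vertexOfTail s) ≡ suc (O ↑ʳ join K r s)
    tail (inj₁ i) rewrite dropLast-fromℕ (suc (d i)) = refl
    tail (inj₂ t) = refl
    body : ∀ s → index (vertexOfBody s) ≡ suc (join O (K ℕ.+ r) s)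
    body (inj₁ o) = piece o
    body (inj₂ w) = trans (tail (splitAt K w)) (cong (λ x → suc (O ↑ʳ x)) (join-splitAt K r w))

  vertex-injective : ∀ u w → vertex u ≡ vertex w → u ≡ w
  vertex-injective u w eq = trans (sym (index-vertex u)) (trans (cong index eq) (index-vertex w))

  _≟V_ : (x y : Vertex) → Dec (x ≡ y)
  apex   ≟V apex    = yes refl
  twin t ≟V twin t′ with t F.≟ t′
  ... | yes refl = yes refl
  ... | no t≢t′  = no (λ { refl → t≢t′ refl })
  av i s ≟V av i′ s′ with i F.≟ i′
  ... | no i≢i′  = no (λ { refl → i≢i′ refl })
  ... | yes refl with s F.≟ s′
  ...   | yes refl = yes refl
  ...   | no s≢s′  = no (λ { refl → s≢s′ refl })
  bv i t ≟V bv i′ t′ with i F.≟ i′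
  ... | no i≢i′  = no (λ { refl → i≢i′ refl })
  ... | yes refl with t F.≟ t′
  ...   | yes refl = yes refl
  ...   | no t≢t′  = no (λ { refl → t≢t′ refl })
  apex   ≟V twin _  = no (λ ())
  apex   ≟V av _ _  = no (λ ())
  apex   ≟V bv _ _  = no (λ ())
  twin _ ≟V apex    = no (λ ())
  twin _ ≟V av _ _  = no (λ ())
  twin _ ≟V bv _ _  = no (λ ())
  av _ _ ≟V apex    = no (λ ())
  av _ _ ≟V twin _  = no (λ ())
  av _ _ ≟V bv _ _  = no (λ ())
  bv _ _ ≟V apex    = no (λ ())
  bv _ _ ≟V twin _  = no (λ ())
  bv _ _ ≟V av _ _  = no (λ ())

  eqV : Vertex → Vertex → Bool
  eqV x y = ⌊ x ≟V y ⌋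

  ≟-vertex : ∀ u w → ⌊ u F.≟ w ⌋ ≡ eqV (vertex u) (vertex w)
  ≟-vertex u w with u F.≟ w | vertex u ≟V vertex w
  ... | yes _    | yes _  = refl
  ... | no _     | no _   = refl
  ... | yes refl | no ≢   = ⊥-elim (≢ refl)
  ... | no u≢w   | yes eq = ⊥-elim (u≢w (vertex-injective u w eq))

  adjV : Vertex → Vertex → Bool
  adjV apex     (twin _)  = true
  adjV (twin _) apex      = true
  adjV (twin t) (twin t′) = not ⌊ t F.≟ t′ ⌋
  adjV (av i s) (bv i′ t) = ⌊ i F.≟ i′ ⌋ ∧ not (toℕ s ℕ.≡ᵇ toℕ t)
  adjV (bv i′ t) (av i s) = ⌊ i F.≟ i′ ⌋ ∧ not (toℕ s ℕ.≡ᵇ toℕ t)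
  adjV _        _         = false

  adjV-sym : ∀ x y → adjV x y ≡ adjV y x
  adjV-sym apex     apex      = refl
  adjV-sym apex     (twin _)  = refl
  adjV-sym apex     (av _ _)  = refl
  adjV-sym apex     (bv _ _)  = refl
  adjV-sym (twin _) apex      = refl
  adjV-sym (twin t) (twin t′) = cong not (⌊≟⌋-sym t t′)
  adjV-sym (twin _) (av _ _)  = refl
  adjV-sym (twin _) (bv _ _)  = refl
  adjV-sym (av _ _) apex      = refl
  adjV-sym (av _ _) (twin _)  = refl
  adjV-sym (av _ _) (av _ _)  = refl
  adjV-sym (av _ _) (bv _ _)  = refl
  adjV-sym (bv _ _) apex      = refl
  adjV-sym (bv _ _) (twin _)  = refl
  adjV-sym (bv _ _) (av _ _)  = refl
  adjV-sym (bv _ _) (bv _ _)  = refl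

  adjV-irrefl : ∀ x → adjV x x ≡ false
  adjV-irrefl apex     = refl
  adjV-irrefl (twin t) rewrite ≟-refl t = refl
  adjV-irrefl (av _ _) = refl
  adjV-irrefl (bv _ _) = refl

  Γ : Graph m
  Γ = record { adj    = λ u w → adjV (vertex u) (vertex w)
             ; sym    = λ u w → adjV-sym (vertex u) (vertex w)
             ; irrefl = λ u → adjV-irrefl (vertex u) }

  closedV : Vertex → Vertex → Bool
  closedV x y = eqV x y ∨ adjV x y

  closedNbhd-vertex : ∀ u w → closedNbhd Γ u w ≡ closedV (vertex u) (vertex w)
  closedNbhd-vertex u w = cong (_∨ adjV (vertex u) (vertex w)) (≟-vertex u w)

  δV : Vertex → Vertex → ℤ
  δV x y = ι (eqV x y)

  δV-vertex : ∀ u w → δV (vertex u) (vertex w) ≡ δ u w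
  δV-vertex u w = trans (cong ι (sym (≟-vertex u w))) (ι-≟ u w)

  δV-sym : ∀ x y → δV x y ≡ δV y x
  δV-sym x y with x ≟V y | y ≟V x
  ... | yes _   | yes _   = refl
  ... | no _    | no _    = refl
  ... | yes x≡y | no y≢x  = ⊥-elim (y≢x (sym x≡y))
  ... | no x≢y  | yes y≡x = ⊥-elim (x≢y (sym y≡x))

  δV-av-av : ∀ i s s′ → δV (av i s) (av i s′) ≡ δ s s′
  δV-av-av i s s′ rewrite ≟-refl i with s F.≟ s′
  ... | yes refl = refl
  ... | no _     = refl

  δV-bv-bv : ∀ i t t′ → δV (bv i t) (bv i t′) ≡ δ t t′
  δV-bv-bv i t t′ rewrite ≟-refl i with t F.≟ t′
  ... | yes refl = refl
  ... | no _     = refl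

  δV-twin-twin : ∀ t t′ → δV (twin t) (twin t′) ≡ δ t t′
  δV-twin-twin t t′ with t F.≟ t′
  ... | yes refl = refl
  ... | no _     = refl

  eqV-av-av≢ : ∀ {i i′} s s′ → i ≢ i′ → eqV (av i s) (av i′ s′) ≡ false
  eqV-av-av≢ {i} {i′} s s′ i≢i′ with i F.≟ i′
  ... | yes i≡i′ = ⊥-elim (i≢i′ i≡i′)
  ... | no _     = refl

  eqV-bv-bv≢ : ∀ {i i′} t t′ → i ≢ i′ → eqV (bv i t) (bv i′ t′) ≡ false
  eqV-bv-bv≢ {i} {i′} t t′ i≢i′ with i F.≟ i′
  ... | yes i≡i′ = ⊥-elim (i≢i′ i≡i′)
  ... | no _     = refl

  sumℤ-δV : ∀ (f : Vertex → ℤ) y → sumℤ (λ w → f (vertex w) * δV (vertex w) y) ≡ f y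
  sumℤ-δV f y = begin
    sumℤ (λ w → f (vertex w) * δV (vertex w) y)
      ≡⟨ sumℤ-cong (λ w → cong (λ x → f (vertex w) * x)
                      (trans (cong (δV (vertex w)) (sym (vertex-index y))) (δV-vertex w (index y)))) ⟩
    sumℤ (λ w → f (vertex w) * δ w (index y))
      ≡⟨ sumℤ-δʳ (index y) (f ∘ vertex) ⟩
    f (vertex (index y))
      ≡⟨ cong f (vertex-index y) ⟩
    f y ∎

  sumℤ-δV-combination : ∀ {n} (f : Vertex → ℤ) (c : Fin n → ℤ) (p : Fin n → Vertex) →
    sumℤ (λ w → f (vertex w) * sumℤ (λ j → c j * δV (vertex w) (p j))) ≡ sumℤ (λ j → c j * f (p j))
  sumℤ-δV-combination f c p = begin
    sumℤ (λ w → f (vertex w) * sumℤ (λ j → c j * δV (vertex w) (p j)))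
      ≡⟨ sumℤ-cong (λ w → sym (sumℤ-*ˡ (f (vertex w)) (λ j → c j * δV (vertex w) (p j)))) ⟩
    sumℤ (λ w → sumℤ (λ j → f (vertex w) * (c j * δV (vertex w) (p j))))
      ≡⟨ sumℤ-swap (λ w j → f (vertex w) * (c j * δV (vertex w) (p j))) ⟩
    sumℤ (λ j → sumℤ (λ w → f (vertex w) * (c j * δV (vertex w) (p j))))
      ≡⟨ sumℤ-cong (λ j → trans (sumℤ-cong (λ w → swap (f (vertex w)) (c j) (δV (vertex w) (p j))))
                          (trans (sumℤ-*ˡ (c j) (λ w → f (vertex w) * δV (vertex w) (p j)))
                                 (cong (c j *_) (sumℤ-δV f (p j))))) ⟩
    sumℤ (λ j → c j * f (p j)) ∎
    where swap : ∀ a b c → a * (b * c) ≡ b * (a * c)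
          swap = solve-∀

  closed-av-av : ∀ i p s → ι (closedV (av i p) (av i s)) ≡ δ p s
  closed-av-av i p s = trans (ι-∨-false _) (δV-av-av i p s)

  closed-bv-bv : ∀ i q t → ι (closedV (bv i q) (bv i t)) ≡ δ q t
  closed-bv-bv i q t = trans (ι-∨-false _) (δV-bv-bv i q t)

  closed-av-bv : ∀ i p t → ι (closedV (av i p) (bv i t)) ≡ 1ℤ - δ p t
  closed-av-bv i p t rewrite ≟-refl i = ι-not-≡ᵇ p t

  closed-bv-av : ∀ i q s → ι (closedV (bv i q) (av i s)) ≡ 1ℤ - δ s q
  closed-bv-av i q s rewrite ≟-refl i = ι-not-≡ᵇ s q

  closed-av-av≢ : ∀ {i i′} p s → i ≢ i′ → ι (closedV (av i p) (av i′ s)) ≡ 0ℤ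
  closed-av-av≢ p s i≢i′ rewrite eqV-av-av≢ p s i≢i′ = refl

  closed-bv-bv≢ : ∀ {i i′} q t → i ≢ i′ → ι (closedV (bv i q) (bv i′ t)) ≡ 0ℤ
  closed-bv-bv≢ q t i≢i′ rewrite eqV-bv-bv≢ q t i≢i′ = refl

  closed-av-bv≢ : ∀ {i i′} p t → i ≢ i′ → ι (closedV (av i p) (bv i′ t)) ≡ 0ℤ
  closed-av-bv≢ p t i≢i′ rewrite ≟-≢ i≢i′ = refl

  closed-bv-av≢ : ∀ {i i′} q s → i ≢ i′ → ι (closedV (bv i q) (av i′ s)) ≡ 0ℤ
  closed-bv-av≢ q s i≢i′ rewrite ≟-≢ (i≢i′ ∘ sym) = refl

  closed-twin : ∀ x t → closedV x (twin t) ≡ closedV x apex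
  closed-twin apex      t = refl
  closed-twin (twin t′) t with t′ F.≟ t
  ... | yes refl = refl
  ... | no _     = refl
  closed-twin (av _ _)  t = refl
  closed-twin (bv _ _)  t = refl

  meetRow : Vertex → Vertex → Vertex → ℤ
  meetRow x y z = ι (closedV x z ∧ closedV y z)

  meetRow-av-bv : ∀ i p q z → meetRow (av i p) (bv i q) z ≡ (1ℤ - δ p q) * (δV (av i p) z + δV (bv i q) z)
  meetRow-av-bv i p q apex     = sym (ℤP.*-zeroʳ (1ℤ - δ p q))
  meetRow-av-bv i p q (twin _) = sym (ℤP.*-zeroʳ (1ℤ - δ p q))
  meetRow-av-bv i p q (av i′ s) = by-component (i F.≟ i′)
    where
    by-component : Dec (i ≡ i′) →
      meetRow (av i p) (bv i q) (av i′ s) ≡ (1ℤ - δ p q) * (δV (av i p) (av i′ s) + δV (bv i q) (av i′ s))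
    by-component (yes refl) = begin
        ι (closedV (av i p) (av i s) ∧ closedV (bv i q) (av i s))
          ≡⟨ ι-∧ (closedV (av i p) (av i s)) _ ⟩
        ι (closedV (av i p) (av i s)) * ι (closedV (bv i q) (av i s))
          ≡⟨ cong₂ _*_ (closed-av-av i p s) (closed-bv-av i q s) ⟩
        δ p s * (1ℤ - δ s q)
          ≡⟨ δ-*-subst p s (λ x → 1ℤ - δ x q) ⟩
        δ p s * (1ℤ - δ p q)
          ≡⟨ reorder (δ p s) (1ℤ - δ p q) ⟩
        (1ℤ - δ p q) * (δ p s + 0ℤ)
          ≡⟨ cong (λ x → (1ℤ - δ p q) * (x + 0ℤ)) (sym (δV-av-av i p s)) ⟩
        (1ℤ - δ p q) * (δV (av i p) (av i s) + δV (bv i q) (av i s)) ∎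
      where reorder : ∀ a b → a * b ≡ b * (a + 0ℤ)
            reorder = solve-∀
    by-component (no i≢i′)
      rewrite ι-∧ (closedV (av i p) (av i′ s)) (closedV (bv i q) (av i′ s))
            | closed-av-av≢ p s i≢i′ | eqV-av-av≢ p s i≢i′ = sym (ℤP.*-zeroʳ (1ℤ - δ p q))
  meetRow-av-bv i p q (bv i′ t) = by-component (i F.≟ i′)
    where
    by-component : Dec (i ≡ i′) →
      meetRow (av i p) (bv i q) (bv i′ t) ≡ (1ℤ - δ p q) * (δV (av i p) (bv i′ t) + δV (bv i q) (bv i′ t))
    by-component (yes refl) = begin
        ι (closedV (av i p) (bv i t) ∧ closedV (bv i q) (bv i t))
          ≡⟨ ι-∧ (closedV (av i p) (bv i t)) _ ⟩
        ι (closedV (av i p) (bv i t)) * ι (closedV (bv i q) (bv i t))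
          ≡⟨ cong₂ _*_ (closed-av-bv i p t) (closed-bv-bv i q t) ⟩
        (1ℤ - δ p t) * δ q t
          ≡⟨ ℤP.*-comm (1ℤ - δ p t) (δ q t) ⟩
        δ q t * (1ℤ - δ p t)
          ≡⟨ δ-*-subst q t (λ x → 1ℤ - δ p x) ⟩
        δ q t * (1ℤ - δ p q)
          ≡⟨ ℤP.*-comm (δ q t) (1ℤ - δ p q) ⟩
        (1ℤ - δ p q) * δ q t
          ≡⟨ cong ((1ℤ - δ p q) *_) (sym (trans (ℤP.+-identityˡ _) (δV-bv-bv i q t))) ⟩
        (1ℤ - δ p q) * (δV (av i p) (bv i t) + δV (bv i q) (bv i t)) ∎
    by-component (no i≢i′)
      rewrite ι-∧ (closedV (av i p) (bv i′ t)) (closedV (bv i q) (bv i′ t))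
            | closed-av-bv≢ p t i≢i′ | eqV-bv-bv≢ q t i≢i′ = sym (ℤP.*-zeroʳ (1ℤ - δ p q))

  closed-av-expand : ∀ i p z →
    ι (closedV (av i p) z) ≡ δV (av i p) z + sumℤ (λ t → (1ℤ - δ p t) * δV (bv i t) z)
  closed-av-expand i p apex     = sym (cong (λ x → 0ℤ + x) (sumℤ-*0 (λ t → 1ℤ - δ p t)))
  closed-av-expand i p (twin _) = sym (cong (λ x → 0ℤ + x) (sumℤ-*0 (λ t → 1ℤ - δ p t)))
  closed-av-expand i p z@(av i′ s) = by-component (i F.≟ i′)
    where
    by-component : Dec (i ≡ i′) →
      ι (closedV (av i p) z) ≡ δV (av i p) z + sumℤ (λ t → (1ℤ - δ p t) * δV (bv i t) z)
    by-component (yes refl) = trans (closed-av-av i p s)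
      (sym (trans (cong₂ _+_ (δV-av-av i p s) (sumℤ-*0 (λ t → 1ℤ - δ p t))) (ℤP.+-identityʳ _)))
    by-component (no i≢i′) = trans (closed-av-av≢ p s i≢i′)
      (sym (cong₂ _+_ (cong ι (eqV-av-av≢ p s i≢i′)) (sumℤ-*0 (λ t → 1ℤ - δ p t))))
  closed-av-expand i p z@(bv i′ t₀) = by-component (i F.≟ i′)
    where
    by-component : Dec (i ≡ i′) →
      ι (closedV (av i p) z) ≡ δV (av i p) z + sumℤ (λ t → (1ℤ - δ p t) * δV (bv i t) z)
    by-component (yes refl) = trans (closed-av-bv i p t₀) (sym (trans (ℤP.+-identityˡ _)
      (trans (sumℤ-cong (λ t → cong ((1ℤ - δ p t) *_) (δV-bv-bv i t t₀))) (sumℤ-δʳ t₀ (λ t → 1ℤ - δ p t)))))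
    by-component (no i≢i′) = trans (closed-av-bv≢ p t₀ i≢i′) (sym (trans (ℤP.+-identityˡ _)
      (trans (sumℤ-cong (λ t → cong ((1ℤ - δ p t) *_) (cong ι (eqV-bv-bv≢ t t₀ i≢i′)))) (sumℤ-*0 (λ t → 1ℤ - δ p t)))))

  closed-apex-expand : ∀ z → ι (closedV apex z) ≡ δV apex z + sumℤ (λ t → 1ℤ * δV (twin t) z)
  closed-apex-expand apex      = sym (cong (λ x → 1ℤ + x) (sumℤ-*0 {r} (λ _ → 1ℤ)))
  closed-apex-expand (twin t₀) = sym (trans (ℤP.+-identityˡ _)
    (trans (sumℤ-cong (λ t → cong (1ℤ *_) (δV-twin-twin t t₀))) (sumℤ-δʳ t₀ (λ _ → 1ℤ))))
  closed-apex-expand (av i s)  = sym (cong (λ x → 0ℤ + x) (sumℤ-*0 {r} (λ _ → 1ℤ)))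
  closed-apex-expand (bv i s)  = sym (cong (λ x → 0ℤ + x) (sumℤ-*0 {r} (λ _ → 1ℤ)))

  collect : Fin K → (Vertex → ℤ) → ℤ
  collect i g = sumℤ (λ s → - 1ℤ * g (av i s)) + sumℤ (λ t → (1ℤ - δ t (last i)) * g (bv i t))

  -- NQ y z is the coefficient of column y in the new column z: Q = I ⊕ NQ subtracts the apex
  -- column from every twin column and adds Σ_{t ≠ last} bᵢ(t) − Σ_s aᵢ(s) to column bᵢ(last).
  NQ : Vertex → Vertex → ℤ
  NQ y apex     = 0ℤ
  NQ y (twin t) = - δV y apex
  NQ y (av i s) = 0ℤ
  NQ y (bv i t) = δ t (last i) * collect i (δV y)

  collect-outside : ∀ i g → (∀ s → g (av i s) ≡ 0ℤ) → (∀ t → g (bv i t) ≡ 0ℤ) → collect i g ≡ 0ℤ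
  collect-outside i g a∉ b∉ = cong₂ _+_
    (trans (sumℤ-cong (λ s → cong (- 1ℤ *_) (a∉ s))) (sumℤ-*0 {suc (suc (d i))} (λ _ → - 1ℤ)))
    (trans (sumℤ-cong (λ t → cong ((1ℤ - δ t (last i)) *_) (b∉ t))) (sumℤ-*0 (λ t → 1ℤ - δ t (last i))))

  collect-av : ∀ i p → collect i (δV (av i p)) ≡ - 1ℤ
  collect-av i p = begin
    collect i (δV (av i p))
      ≡⟨ cong₂ _+_ (trans (sumℤ-cong (λ s → cong (- 1ℤ *_) (trans (δV-av-av i p s) (δ-sym p s))))
                          (sumℤ-δʳ p (λ _ → - 1ℤ)))
                   (sumℤ-*0 (λ t → 1ℤ - δ t (last i))) ⟩
    - 1ℤ + 0ℤ ∎

  collect-bv : ∀ i q → collect i (δV (bv i q)) ≡ 1ℤ - δ q (last i)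
  collect-bv i q = begin
    collect i (δV (bv i q))
      ≡⟨ cong₂ _+_ (sumℤ-*0 {suc (suc (d i))} (λ _ → - 1ℤ))
                   (trans (sumℤ-cong (λ t → cong ((1ℤ - δ t (last i)) *_) (trans (δV-bv-bv i q t) (δ-sym q t))))
                          (sumℤ-δʳ q (λ t → 1ℤ - δ t (last i)))) ⟩
    0ℤ + (1ℤ - δ q (last i))       ≡⟨ ℤP.+-identityˡ _ ⟩
    1ℤ - δ q (last i) ∎

  collect-av≢ : ∀ {i i′} p → i ≢ i′ → collect i′ (δV (av i p)) ≡ 0ℤ
  collect-av≢ {i} {i′} p i≢i′ = collect-outside i′ (δV (av i p)) (λ s → cong ι (eqV-av-av≢ p s i≢i′)) (λ _ → refl)

  collect-bv≢ : ∀ {i i′} q → i ≢ i′ → collect i′ (δV (bv i q)) ≡ 0ℤ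
  collect-bv≢ {i} {i′} q i≢i′ = collect-outside i′ (δV (bv i q)) (λ _ → refl) (λ t → cong ι (eqV-bv-bv≢ q t i≢i′))

  NQ-apex : ∀ z → NQ apex z ≡ sumℤ (λ t → - 1ℤ * δV (twin t) z)
  NQ-apex apex      = sym (sumℤ-*0 {r} (λ _ → - 1ℤ))
  NQ-apex (twin t₀) = sym (trans (sumℤ-cong (λ t → cong (- 1ℤ *_) (δV-twin-twin t t₀))) (sumℤ-δʳ t₀ (λ _ → - 1ℤ)))
  NQ-apex (av _ _)  = sym (sumℤ-*0 {r} (λ _ → - 1ℤ))
  NQ-apex (bv i t)  = trans (cong (δ t (last i) *_) (collect-outside i (δV apex) (λ _ → refl) (λ _ → refl)))
                            (trans (ℤP.*-zeroʳ (δ t (last i))) (sym (sumℤ-*0 {r} (λ _ → - 1ℤ))))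

  NQ-twin : ∀ t z → NQ (twin t) z ≡ 0ℤ
  NQ-twin t apex      = refl
  NQ-twin t (twin _)  = refl
  NQ-twin t (av _ _)  = refl
  NQ-twin t (bv i t′) = trans (cong (δ t′ (last i) *_) (collect-outside i (δV (twin t)) (λ _ → refl) (λ _ → refl)))
                              (ℤP.*-zeroʳ (δ t′ (last i)))

  NQ-av : ∀ i p z → NQ (av i p) z ≡ - δV (bv i (last i)) z
  NQ-av i p apex       = refl
  NQ-av i p (twin _)   = refl
  NQ-av i p (av _ _)   = refl
  NQ-av i p (bv i′ t) = by-component (i F.≟ i′)
    where
    by-component : Dec (i ≡ i′) → NQ (av i p) (bv i′ t) ≡ - δV (bv i (last i)) (bv i′ t)
    by-component (yes refl) = begin
      δ t (last i) * collect i (δV (av i p))   ≡⟨ cong (δ t (last i) *_) (collect-av i p) ⟩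
      δ t (last i) * - 1ℤ                 ≡⟨ ℤP.*-comm (δ t (last i)) (- 1ℤ) ⟩
      - 1ℤ * δ t (last i)                 ≡⟨ ℤP.-1*i≡-i (δ t (last i)) ⟩
      - δ t (last i)                      ≡⟨ cong -_ (trans (δ-sym t (last i)) (sym (δV-bv-bv i (last i) t))) ⟩
      - δV (bv i (last i)) (bv i t) ∎
    by-component (no i≢i′) = begin
      δ t (last i′) * collect i′ (δV (av i p)) ≡⟨ cong (δ t (last i′) *_) (collect-av≢ p i≢i′) ⟩
      δ t (last i′) * 0ℤ                  ≡⟨ ℤP.*-zeroʳ (δ t (last i′)) ⟩
      - 0ℤ                                ≡⟨ cong -_ (sym (cong ι (eqV-bv-bv≢ (last i) t i≢i′))) ⟩
      - δV (bv i (last i)) (bv i′ t) ∎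

  NQ-bv : ∀ i q z → NQ (bv i q) z ≡ (1ℤ - δ q (last i)) * δV (bv i (last i)) z
  NQ-bv i q apex     = sym (ℤP.*-zeroʳ (1ℤ - δ q (last i)))
  NQ-bv i q (twin _) = sym (ℤP.*-zeroʳ (1ℤ - δ q (last i)))
  NQ-bv i q (av _ _) = sym (ℤP.*-zeroʳ (1ℤ - δ q (last i)))
  NQ-bv i q (bv i′ t) = by-component (i F.≟ i′)
    where
    by-component : Dec (i ≡ i′) → NQ (bv i q) (bv i′ t) ≡ (1ℤ - δ q (last i)) * δV (bv i (last i)) (bv i′ t)
    by-component (yes refl) = begin
      δ t (last i) * collect i (δV (bv i q))   ≡⟨ cong (δ t (last i) *_) (collect-bv i q) ⟩
      δ t (last i) * (1ℤ - δ q (last i))  ≡⟨ ℤP.*-comm (δ t (last i)) _ ⟩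
      (1ℤ - δ q (last i)) * δ t (last i)
        ≡⟨ cong ((1ℤ - δ q (last i)) *_) (trans (δ-sym t (last i)) (sym (δV-bv-bv i (last i) t))) ⟩
      (1ℤ - δ q (last i)) * δV (bv i (last i)) (bv i t) ∎
    by-component (no i≢i′) = begin
      δ t (last i′) * collect i′ (δV (bv i q)) ≡⟨ cong (δ t (last i′) *_) (collect-bv≢ q i≢i′) ⟩
      δ t (last i′) * 0ℤ                  ≡⟨ ℤP.*-zeroʳ (δ t (last i′)) ⟩
      0ℤ                                  ≡⟨ ℤP.*-zeroʳ (1ℤ - δ q (last i)) ⟨
      (1ℤ - δ q (last i)) * 0ℤ
        ≡⟨ cong ((1ℤ - δ q (last i)) *_) (sym (cong ι (eqV-bv-bv≢ (last i) t i≢i′))) ⟩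
      (1ℤ - δ q (last i)) * δV (bv i (last i)) (bv i′ t) ∎

  timesQ : (Vertex → ℤ) → Vertex → ℤ
  timesQ g z = g z + sumℤ (λ w → g (vertex w) * NQ (vertex w) z)

  timesQ-cong : ∀ {g h : Vertex → ℤ} → (∀ y → g y ≡ h y) → ∀ z → timesQ g z ≡ timesQ h z
  timesQ-cong g≗h z = cong₂ _+_ (g≗h z) (sumℤ-cong (λ w → cong (_* NQ (vertex w) z) (g≗h (vertex w))))

  timesQ-+ : ∀ (g h : Vertex → ℤ) z → timesQ (λ y → g y + h y) z ≡ timesQ g z + timesQ h z
  timesQ-+ g h z = begin
    (g z + h z) + sumℤ (λ w → (g (vertex w) + h (vertex w)) * NQ (vertex w) z)
      ≡⟨ cong (λ x → (g z + h z) + x)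
           (trans (sumℤ-cong (λ w → ℤP.*-distribʳ-+ (NQ (vertex w) z) (g (vertex w)) (h (vertex w))))
                  (sumℤ-+ (λ w → g (vertex w) * NQ (vertex w) z) (λ w → h (vertex w) * NQ (vertex w) z))) ⟩
    (g z + h z) + (sumℤ (λ w → g (vertex w) * NQ (vertex w) z) + sumℤ (λ w → h (vertex w) * NQ (vertex w) z))
      ≡⟨ interchange (g z) (h z) _ _ ⟩
    timesQ g z + timesQ h z ∎
    where interchange : ∀ a b c d → (a + b) + (c + d) ≡ (a + c) + (b + d)
          interchange = solve-∀

  timesQ-* : ∀ (c : ℤ) (g : Vertex → ℤ) z → timesQ (λ y → c * g y) z ≡ c * timesQ g z
  timesQ-* c g z = begin
    c * g z + sumℤ (λ w → (c * g (vertex w)) * NQ (vertex w) z)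
      ≡⟨ cong (λ x → c * g z + x) (trans (sumℤ-cong (λ w → ℤP.*-assoc c (g (vertex w)) (NQ (vertex w) z)))
                                          (sumℤ-*ˡ c (λ w → g (vertex w) * NQ (vertex w) z))) ⟩
    c * g z + c * sumℤ (λ w → g (vertex w) * NQ (vertex w) z)
      ≡⟨ ℤP.*-distribˡ-+ c _ _ ⟨
    c * timesQ g z ∎

  timesQ-δV : ∀ x z → timesQ (δV x) z ≡ δV x z + NQ x z
  timesQ-δV x z = cong (λ y → δV x z + y) (begin
    sumℤ (λ w → δV x (vertex w) * NQ (vertex w) z)
      ≡⟨ sumℤ-cong (λ w → trans (ℤP.*-comm (δV x (vertex w)) (NQ (vertex w) z)) (cong (NQ (vertex w) z *_) (δV-sym x (vertex w)))) ⟩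
    sumℤ (λ w → NQ (vertex w) z * δV (vertex w) x)
      ≡⟨ sumℤ-δV (λ y → NQ y z) x ⟩
    NQ x z ∎)

  timesQ-combination : ∀ {n} (c : Fin n → ℤ) (p : Fin n → Vertex) z →
    timesQ (λ y → sumℤ (λ j → c j * δV (p j) y)) z ≡ sumℤ (λ j → c j * (δV (p j) z + NQ (p j) z))
  timesQ-combination {zero}  c p z = trans (ℤP.+-identityˡ _) (sumℤ-zero {m} (λ w → refl))
  timesQ-combination {suc n} c p z =
    trans (timesQ-+ (λ y → c zero * δV (p zero) y) (λ y → sumℤ (λ j → c (suc j) * δV (p (suc j)) y)) z)
          (cong₂ _+_ (trans (timesQ-* (c zero) (δV (p zero)) z) (cong (c zero *_) (timesQ-δV (p zero) z)))
                     (timesQ-combination (c ∘ suc) (p ∘ suc) z))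

  timesQ-apex : ∀ g → timesQ g apex ≡ g apex
  timesQ-apex g = trans (cong (λ x → g apex + x) (sumℤ-zero (λ w → ℤP.*-zeroʳ (g (vertex w))))) (ℤP.+-identityʳ _)

  timesQ-av : ∀ g i s → timesQ g (av i s) ≡ g (av i s)
  timesQ-av g i s = trans (cong (λ x → g (av i s) + x) (sumℤ-zero (λ w → ℤP.*-zeroʳ (g (vertex w))))) (ℤP.+-identityʳ _)

  timesQ-twin : ∀ g t → timesQ g (twin t) ≡ g (twin t) - g apex
  timesQ-twin g t = cong (λ x → g (twin t) + x) (begin
    sumℤ (λ w → g (vertex w) * - δV (vertex w) apex)
      ≡⟨ sumℤ-cong (λ w → sym (ℤP.neg-distribʳ-* (g (vertex w)) (δV (vertex w) apex))) ⟩
    sumℤ (λ w → - (g (vertex w) * δV (vertex w) apex))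
      ≡⟨ sumℤ-neg (λ w → g (vertex w) * δV (vertex w) apex) ⟩
    - sumℤ (λ w → g (vertex w) * δV (vertex w) apex)
      ≡⟨ cong -_ (sumℤ-δV g apex) ⟩
    - g apex ∎)

  timesQ-bv : ∀ g i t → timesQ g (bv i t) ≡ g (bv i t) + δ t (last i) * collect i g
  timesQ-bv g i t = cong (λ x → g (bv i t) + x) (begin
    sumℤ (λ w → g (vertex w) * (δ t L * collect i (δV (vertex w))))
      ≡⟨ sumℤ-cong (λ w → distribute (g (vertex w)) (δ t L) (sumℤ (λ s → - 1ℤ * δV (vertex w) (av i s)))
                                      (sumℤ (λ t′ → (1ℤ - δ t′ L) * δV (vertex w) (bv i t′)))) ⟩
    sumℤ (λ w → δ t L * (onA w + onB w))
      ≡⟨ sumℤ-*ˡ (δ t L) (λ w → onA w + onB w) ⟩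
    δ t L * sumℤ (λ w → onA w + onB w)
      ≡⟨ cong (δ t L *_) (trans (sumℤ-+ onA onB)
           (cong₂ _+_ (sumℤ-δV-combination g (λ _ → - 1ℤ) (av i)) (sumℤ-δV-combination g (λ t′ → 1ℤ - δ t′ L) (bv i)))) ⟩
    δ t L * collect i g ∎)
    where
    L = last i
    onA onB : Fin m → ℤ
    onA w = g (vertex w) * sumℤ (λ s → - 1ℤ * δV (vertex w) (av i s))
    onB w = g (vertex w) * sumℤ (λ t′ → (1ℤ - δ t′ L) * δV (vertex w) (bv i t′))
    distribute : ∀ a e x y → a * (e * (x + y)) ≡ e * (a * x + a * y)
    distribute = solve-∀

  divisor : Vertex → ℕ
  divisor apex     = 1
  divisor (twin _) = 0
  divisor (av _ _) = 1
  divisor (bv i t) = if ⌊ t F.≟ last i ⌋ then d i else 1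

  divisor-last : ∀ i → divisor (bv i (last i)) ≡ d i
  divisor-last i rewrite ≟-refl (last i) = refl

  divisor-≢last : ∀ i t → t ≢ last i → divisor (bv i t) ≡ 1
  divisor-≢last i t t≢last rewrite ≟-≢ t≢last = refl

  [1-δ]*divisor : ∀ i t → (1ℤ - δ t (last i)) * + divisor (bv i t) ≡ 1ℤ - δ t (last i)
  [1-δ]*divisor i t with t F.≟ last i
  ... | yes refl = refl
  ... | no _     = ℤP.*-identityʳ _

  δV*divisor : ∀ x z → δV x z * + divisor z ≡ δV x z * + divisor x
  δV*divisor x z with x ≟V z
  ... | yes refl = refl
  ... | no _     = refl

  δV*divisor-unit : ∀ x z → divisor x ≡ 1 → δV x z * + divisor z ≡ δV x z
  δV*divisor-unit x z eq = trans (δV*divisor x z) (trans (cong (λ n → δV x z * + n) eq) (ℤP.*-identityʳ _))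

  -- distinct from last i because dᵢ > 0
  second : ∀ i → Fin (suc (suc (d i)))
  second i = suc zero

  δ-second-last : ∀ i → δ (second i) (last i) ≡ 0ℤ
  δ-second-last i = δ-≢ (λ eq → ℕP.<⇒≢ (d>0 i) (ℕP.suc-injective (trans (cong toℕ eq) (FP.toℕ-fromℕ (suc (d i))))))

  -- Row bᵢ(last) of (I ⊕ NT) · diag e is N[aᵢ(0)] · Q.
  NT : Vertex → Vertex → ℤ
  NT (bv i t) z = δ t (last i) * (δV (av i zero) z + sumℤ (λ t′ → ((1ℤ - δ zero t′) * (1ℤ - δ t′ (last i))) * δV (bv i t′) z))
  NT _        _ = 0ℤ

  NT-square-zero : ∀ x y z → NT x y * NT y z ≡ 0ℤ
  NT-square-zero apex     y z = refl
  NT-square-zero (twin _) y z = refl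
  NT-square-zero (av _ _) y z = refl
  NT-square-zero (bv i t) apex       z = ℤP.*-zeroʳ (NT (bv i t) apex)
  NT-square-zero (bv i t) (twin t′)  z = ℤP.*-zeroʳ (NT (bv i t) (twin t′))
  NT-square-zero (bv i t) (av i′ s)  z = ℤP.*-zeroʳ (NT (bv i t) (av i′ s))
  NT-square-zero (bv i t) (bv i′ t″) z = by-component (i F.≟ i′)
    where
    w : ∀ {i} → Fin (suc (suc (d i))) → ℤ
    w {i} t′ = (1ℤ - δ zero t′) * (1ℤ - δ t′ (last i))
    by-component : Dec (i ≡ i′) → NT (bv i t) (bv i′ t″) * NT (bv i′ t″) z ≡ 0ℤ
    by-component (yes refl) = begin
      δ t L * (0ℤ + sumℤ (λ t′ → w t′ * δV (bv i t′) (bv i t″))) * (δ t″ L * R)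
        ≡⟨ cong (λ x → δ t L * (0ℤ + x) * (δ t″ L * R))
             (trans (sumℤ-cong (λ t′ → cong (w t′ *_) (δV-bv-bv i t′ t″))) (sumℤ-δʳ t″ w)) ⟩
      δ t L * (0ℤ + (1ℤ - δ zero t″) * (1ℤ - δ t″ L)) * (δ t″ L * R)
        ≡⟨ reorder (δ t L) (1ℤ - δ zero t″) (1ℤ - δ t″ L) (δ t″ L) R ⟩
      (δ t L * (1ℤ - δ zero t″) * R) * ((1ℤ - δ t″ L) * δ t″ L)
        ≡⟨ cong ((δ t L * (1ℤ - δ zero t″) * R) *_) (δ-idempotent t″ L) ⟩
      (δ t L * (1ℤ - δ zero t″) * R) * 0ℤ
        ≡⟨ ℤP.*-zeroʳ (δ t L * (1ℤ - δ zero t″) * R) ⟩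
      0ℤ ∎
      where
      L = last i
      R = δV (av i zero) z + sumℤ (λ t′ → w t′ * δV (bv i t′) z)
      reorder : ∀ a b c e r → a * (0ℤ + b * c) * (e * r) ≡ (a * b * r) * (c * e)
      reorder = solve-∀
    by-component (no i≢i′) = begin
      δ t (last i) * (0ℤ + sumℤ (λ t′ → w t′ * δV (bv i t′) (bv i′ t″))) * NT (bv i′ t″) z
        ≡⟨ cong (λ x → δ t (last i) * (0ℤ + x) * NT (bv i′ t″) z)
             (trans (sumℤ-cong (λ t′ → cong (w t′ *_) (cong ι (eqV-bv-bv≢ t′ t″ i≢i′)))) (sumℤ-*0 w)) ⟩
      δ t (last i) * 0ℤ * NT (bv i′ t″) z
        ≡⟨ cong (_* NT (bv i′ t″) z) (ℤP.*-zeroʳ (δ t (last i))) ⟩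
      0ℤ ∎

  NQ-square-zero : ∀ x y z → NQ x y * NQ y z ≡ 0ℤ
  NQ-square-zero x apex     z = refl
  NQ-square-zero x (twin t) z = trans (cong (NQ x (twin t) *_) (NQ-twin t z)) (ℤP.*-zeroʳ (NQ x (twin t)))
  NQ-square-zero x (av _ _) z = refl
  NQ-square-zero x (bv i t) z = begin
    (δ t L * S) * NQ (bv i t) z                    ≡⟨ cong ((δ t L * S) *_) (NQ-bv i t z) ⟩
    (δ t L * S) * ((1ℤ - δ t L) * δV (bv i L) z)   ≡⟨ reorder (δ t L) S (1ℤ - δ t L) (δV (bv i L) z) ⟩
    ((1ℤ - δ t L) * δ t L) * (S * δV (bv i L) z)   ≡⟨ cong (_* (S * δV (bv i L) z)) (δ-idempotent t L) ⟩
    0ℤ ∎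
    where
    L = last i
    S = collect i (δV x)
    reorder : ∀ a s b c → (a * s) * (b * c) ≡ (b * a) * (s * c)
    reorder = solve-∀

  -- The closed-neighbourhood row of x is replaced by this combination of intersection rows
  -- (N[x] ∩ N[x] = N[x] is one of them, so this is an elementary row operation).
  reduction : Vertex → List (ℤ × Vertex × Vertex)
  reduction apex     = (1ℤ , apex , apex) ∷ []
  reduction (twin _) = []
  reduction (av i s) = (1ℤ - δ s (last i) , av i s          , bv i (last i))
                     ∷ (δ s (last i)      , av i (last i)   , bv i zero)
                     ∷ (- δ s (last i)    , av i (second i) , bv i zero)
                     ∷ (δ s (last i)      , av i (second i) , bv i (last i)) ∷ []
  reduction (bv i t) = (1ℤ - δ t (last i)     , av i (last i)   , bv i t)
                     ∷ (- (1ℤ - δ t (last i)) , av i (last i)   , bv i zero)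
                     ∷ (1ℤ - δ t (last i)     , av i (second i) , bv i zero)
                     ∷ (- (1ℤ - δ t (last i)) , av i (second i) , bv i (last i))
                     ∷ (δ t (last i)          , av i zero       , av i zero) ∷ []

  combineRows : List (ℤ × Vertex × Vertex) → Vertex → ℤ
  combineRows []                z = 0ℤ
  combineRows ((c , x , y) ∷ l) z = c * meetRow x y z + combineRows l z

  reducedRow : Vertex → Vertex → ℤ
  reducedRow x = combineRows (reduction x)

  reducedRow-apex : ∀ z → reducedRow apex z ≡ δV apex z + sumℤ (λ t → 1ℤ * δV (twin t) z)
  reducedRow-apex z =
    trans (ℤP.+-identityʳ _) (trans (ℤP.*-identityˡ _) (trans (cong ι (∧-idem (closedV apex z))) (closed-apex-expand z)))

  reducedRow-av : ∀ i s z → reducedRow (av i s) z ≡ δV (av i s) z + δV (bv i (last i)) z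
  reducedRow-av i s z
    rewrite meetRow-av-bv i s (last i) z | meetRow-av-bv i (last i) zero z
          | meetRow-av-bv i (second i) zero z | meetRow-av-bv i (second i) (last i) z
          | δ-second-last i with s F.≟ last i
  ... | yes refl = cancel (δV (av i (last i)) z) (δV (bv i (last i)) z) (δV (bv i zero) z) (δV (av i (second i)) z)
    where cancel : ∀ a b c e → (1ℤ - 1ℤ) * ((1ℤ - 1ℤ) * (a + b)) + (1ℤ * ((1ℤ - 0ℤ) * (a + c))
                     + (- 1ℤ * ((1ℤ - 0ℤ) * (e + c)) + (1ℤ * ((1ℤ - 0ℤ) * (e + b)) + 0ℤ))) ≡ a + b
          cancel = solve-∀
  ... | no _ = cancel (δV (av i s) z) (δV (bv i (last i)) z) (δV (av i (last i)) z) (δV (bv i zero) z) (δV (av i (second i)) z)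
    where cancel : ∀ a b f c e → (1ℤ - 0ℤ) * ((1ℤ - 0ℤ) * (a + b)) + (0ℤ * ((1ℤ - 0ℤ) * (f + c))
                     + (- 0ℤ * ((1ℤ - 0ℤ) * (e + c)) + (0ℤ * ((1ℤ - 0ℤ) * (e + b)) + 0ℤ))) ≡ a + b
          cancel = solve-∀

  reducedRow-bv : ∀ i t z → reducedRow (bv i t) z
    ≡ (1ℤ - δ t (last i)) * (δV (bv i t) z - δV (bv i (last i)) z) + δ t (last i) * ι (closedV (av i zero) z)
  reducedRow-bv i t z
    rewrite meetRow-av-bv i (last i) t z | meetRow-av-bv i (last i) zero z
          | meetRow-av-bv i (second i) zero z | meetRow-av-bv i (second i) (last i) z
          | δ-second-last i | ∧-idem (closedV (av i zero) z) with t F.≟ last i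
  ... | yes refl = cancel (δV (av i (last i)) z) (δV (bv i (last i)) z) (δV (bv i zero) z)
                          (δV (av i (second i)) z) (ι (closedV (av i zero) z))
    where cancel : ∀ a b c e n → (1ℤ - 1ℤ) * ((1ℤ - 1ℤ) * (a + b)) + (- (1ℤ - 1ℤ) * ((1ℤ - 0ℤ) * (a + c))
                     + ((1ℤ - 1ℤ) * ((1ℤ - 0ℤ) * (e + c)) + (- (1ℤ - 1ℤ) * ((1ℤ - 0ℤ) * (e + b)) + (1ℤ * n + 0ℤ))))
                     ≡ (1ℤ - 1ℤ) * (b - b) + 1ℤ * n
          cancel = solve-∀
  ... | no t≢last rewrite δ-≢ (t≢last ∘ sym) =
          cancel (δV (av i (last i)) z) (δV (bv i t) z) (δV (bv i (last i)) z) (δV (bv i zero) z)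
                 (δV (av i (second i)) z) (ι (closedV (av i zero) z))
    where cancel : ∀ a g b c e n → (1ℤ - 0ℤ) * ((1ℤ - 0ℤ) * (a + g)) + (- (1ℤ - 0ℤ) * ((1ℤ - 0ℤ) * (a + c))
                     + ((1ℤ - 0ℤ) * ((1ℤ - 0ℤ) * (e + c)) + (- (1ℤ - 0ℤ) * ((1ℤ - 0ℤ) * (e + b)) + (0ℤ * n + 0ℤ))))
                     ≡ (1ℤ - 0ℤ) * (g - b) + 0ℤ * n
          cancel = solve-∀

  reducedRow-bv-last : ∀ i y → reducedRow (bv i (last i)) y ≡ ι (closedV (av i zero) y)
  reducedRow-bv-last i y = begin
    reducedRow (bv i L) y
      ≡⟨ reducedRow-bv i L y ⟩
    (1ℤ - δ L L) * (δV (bv i L) y - δV (bv i L) y) + δ L L * ι (closedV (av i zero) y)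
      ≡⟨ cong (λ e → (1ℤ - e) * (δV (bv i L) y - δV (bv i L) y) + e * ι (closedV (av i zero) y)) (δ-refl L) ⟩
    (1ℤ - 1ℤ) * (δV (bv i L) y - δV (bv i L) y) + 1ℤ * ι (closedV (av i zero) y)
      ≡⟨ cancel (δV (bv i L) y) (ι (closedV (av i zero) y)) ⟩
    ι (closedV (av i zero) y) ∎
    where
    L = last i
    cancel : ∀ b n → (1ℤ - 1ℤ) * (b - b) + 1ℤ * n ≡ n
    cancel = solve-∀

  reducedRow-bv≢last : ∀ i t y → t ≢ last i → reducedRow (bv i t) y ≡ δV (bv i t) y + - 1ℤ * δV (bv i (last i)) y
  reducedRow-bv≢last i t y t≢last = begin
    reducedRow (bv i t) y
      ≡⟨ reducedRow-bv i t y ⟩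
    (1ℤ - δ t L) * (δV (bv i t) y - δV (bv i L) y) + δ t L * ι (closedV (av i zero) y)
      ≡⟨ cong (λ e → (1ℤ - e) * (δV (bv i t) y - δV (bv i L) y) + e * ι (closedV (av i zero) y)) (δ-≢ t≢last) ⟩
    (1ℤ - 0ℤ) * (δV (bv i t) y - δV (bv i L) y) + 0ℤ * ι (closedV (av i zero) y)
      ≡⟨ simplify (δV (bv i t) y) (δV (bv i L) y) (ι (closedV (av i zero) y)) ⟩
    δV (bv i t) y + - 1ℤ * δV (bv i L) y ∎
    where
    L = last i
    simplify : ∀ a b c → (1ℤ - 0ℤ) * (a - b) + 0ℤ * c ≡ a + - 1ℤ * b
    simplify = solve-∀

  -- the entries of row bᵢ(last) of NT all sit in columns of divisor 1
  NT*divisor : ∀ i z → NT (bv i (last i)) z * + divisor z ≡ NT (bv i (last i)) z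
  NT*divisor i z = begin
    δ L L * (δV (av i zero) z + sumℤ (λ t → w t * X t)) * + divisor z
      ≡⟨ ℤP.*-assoc (δ L L) _ (+ divisor z) ⟩
    δ L L * ((δV (av i zero) z + sumℤ (λ t → w t * X t)) * + divisor z)
      ≡⟨ cong (δ L L *_) (trans (ℤP.*-distribʳ-+ (+ divisor z) (δV (av i zero) z) _)
           (cong₂ _+_ (δV*divisor-unit (av i zero) z refl)
                      (trans (sym (sumℤ-*ʳ (+ divisor z) (λ t → w t * X t))) (sumℤ-cong unit)))) ⟩
    δ L L * (δV (av i zero) z + sumℤ (λ t → w t * X t)) ∎
    where
    L = last i
    w X : Fin (suc (suc (d i))) → ℤ
    w t = (1ℤ - δ zero t) * (1ℤ - δ t L)
    X t = δV (bv i t) z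
    unit : ∀ t → w t * X t * + divisor z ≡ w t * X t
    unit t = begin
      w t * X t * + divisor z                              ≡⟨ ℤP.*-assoc (w t) (X t) (+ divisor z) ⟩
      w t * (X t * + divisor z)                            ≡⟨ cong (w t *_) (δV*divisor (bv i t) z) ⟩
      w t * (X t * + divisor (bv i t))                     ≡⟨ reorder (1ℤ - δ zero t) (1ℤ - δ t L) (X t) (+ divisor (bv i t)) ⟩
      (1ℤ - δ zero t) * ((1ℤ - δ t L) * + divisor (bv i t)) * X t
        ≡⟨ cong (λ e → (1ℤ - δ zero t) * e * X t) ([1-δ]*divisor i t) ⟩
      (1ℤ - δ zero t) * (1ℤ - δ t L) * X t ∎
      where reorder : ∀ c e x f → (c * e) * (x * f) ≡ c * (e * f) * x
            reorder = solve-∀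

  unitRow*divisor : ∀ x z → divisor x ≡ 1 → (δV x z + 0ℤ) * + divisor z ≡ δV x z + 0ℤ
  unitRow*divisor x z eq = trans (cong (_* + divisor z) (ℤP.+-identityʳ (δV x z)))
                                 (trans (δV*divisor-unit x z eq) (sym (ℤP.+-identityʳ (δV x z))))

  reducedRow-timesQ-apex : ∀ z → timesQ (reducedRow apex) z ≡ (δV apex z + NT apex z) * + divisor z
  reducedRow-timesQ-apex z = begin
    timesQ (reducedRow apex) z
      ≡⟨ timesQ-cong reducedRow-apex z ⟩
    timesQ (λ y → δV apex y + sumℤ (λ t → 1ℤ * δV (twin t) y)) z
      ≡⟨ timesQ-+ (δV apex) (λ y → sumℤ (λ t → 1ℤ * δV (twin t) y)) z ⟩
    timesQ (δV apex) z + timesQ (λ y → sumℤ (λ t → 1ℤ * δV (twin t) y)) z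
      ≡⟨ cong₂ _+_ (trans (timesQ-δV apex z) (cong (λ x → δV apex z + x) (NQ-apex z)))
                   (trans (timesQ-combination (λ _ → 1ℤ) twin z)
                          (sumℤ-cong (λ t → cong (λ x → 1ℤ * (δV (twin t) z + x)) (NQ-twin t z)))) ⟩
    (δV apex z + sumℤ (λ t → - 1ℤ * δV (twin t) z)) + sumℤ (λ t → 1ℤ * (δV (twin t) z + 0ℤ))
      ≡⟨ trans (ℤP.+-assoc (δV apex z) _ _) (cong (λ x → δV apex z + x)
           (trans (sym (sumℤ-+ (λ t → - 1ℤ * δV (twin t) z) (λ t → 1ℤ * (δV (twin t) z + 0ℤ))))
                  (sumℤ-zero (λ t → cancel (δV (twin t) z))))) ⟩
    δV apex z + 0ℤ
      ≡⟨ unitRow*divisor apex z refl ⟨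
    (δV apex z + NT apex z) * + divisor z ∎
    where cancel : ∀ a → - 1ℤ * a + 1ℤ * (a + 0ℤ) ≡ 0ℤ
          cancel = solve-∀

  reducedRow-timesQ-twin : ∀ t z → timesQ (reducedRow (twin t)) z ≡ (δV (twin t) z + NT (twin t) z) * + divisor z
  reducedRow-timesQ-twin t z = begin
    timesQ (λ _ → 0ℤ) z                         ≡⟨ timesQ-combination {0} (λ ()) (λ ()) z ⟩
    0ℤ                                          ≡⟨ ℤP.*-zeroʳ (δV (twin t) z) ⟨
    δV (twin t) z * + divisor (twin t)          ≡⟨ δV*divisor (twin t) z ⟨
    δV (twin t) z * + divisor z                 ≡⟨ cong (_* + divisor z) (ℤP.+-identityʳ (δV (twin t) z)) ⟨
    (δV (twin t) z + NT (twin t) z) * + divisor z ∎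

  reducedRow-timesQ-av : ∀ i s z → timesQ (reducedRow (av i s)) z ≡ (δV (av i s) z + NT (av i s) z) * + divisor z
  reducedRow-timesQ-av i s z = begin
    timesQ (reducedRow (av i s)) z
      ≡⟨ timesQ-cong (reducedRow-av i s) z ⟩
    timesQ (λ y → δV (av i s) y + δV bL y) z
      ≡⟨ timesQ-+ (δV (av i s)) (δV bL) z ⟩
    timesQ (δV (av i s)) z + timesQ (δV bL) z
      ≡⟨ cong₂ _+_ (trans (timesQ-δV (av i s) z) (cong (λ x → δV (av i s) z + x) (NQ-av i s z)))
                   (trans (timesQ-δV bL z) (cong (λ x → δV bL z + x)
                      (trans (NQ-bv i L z) (cong (λ e → (1ℤ - e) * δV bL z) (δ-refl L))))) ⟩
    (δV (av i s) z + - δV bL z) + (δV bL z + (1ℤ - 1ℤ) * δV bL z)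
      ≡⟨ cancel (δV (av i s) z) (δV bL z) ⟩
    δV (av i s) z + 0ℤ
      ≡⟨ unitRow*divisor (av i s) z refl ⟨
    (δV (av i s) z + NT (av i s) z) * + divisor z ∎
    where
    L = last i
    bL = bv i L
    cancel : ∀ a b → (a + - b) + (b + (1ℤ - 1ℤ) * b) ≡ a + 0ℤ
    cancel = solve-∀

  reducedRow-timesQ-bv≢last : ∀ i t z → t ≢ last i →
    timesQ (reducedRow (bv i t)) z ≡ (δV (bv i t) z + NT (bv i t) z) * + divisor z
  reducedRow-timesQ-bv≢last i t z t≢last = begin
    timesQ (reducedRow (bv i t)) z
      ≡⟨ timesQ-cong (λ y → reducedRow-bv≢last i t y t≢last) z ⟩
    timesQ (λ y → δV (bv i t) y + - 1ℤ * δV bL y) z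
      ≡⟨ timesQ-+ (δV (bv i t)) (λ y → - 1ℤ * δV bL y) z ⟩
    timesQ (δV (bv i t)) z + timesQ (λ y → - 1ℤ * δV bL y) z
      ≡⟨ cong₂ _+_ (trans (timesQ-δV (bv i t) z) (cong (λ x → δV (bv i t) z + x) (NQ-bv i t z)))
                   (trans (timesQ-* (- 1ℤ) (δV bL) z)
                          (cong (- 1ℤ *_) (trans (timesQ-δV bL z) (cong (λ x → δV bL z + x) (NQ-bv i L z))))) ⟩
    (δV (bv i t) z + (1ℤ - δ t L) * δV bL z) + - 1ℤ * (δV bL z + (1ℤ - δ L L) * δV bL z)
      ≡⟨ cong₂ (λ e f → (δV (bv i t) z + (1ℤ - e) * δV bL z) + - 1ℤ * (δV bL z + (1ℤ - f) * δV bL z))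
               (δ-≢ t≢last) (δ-refl L) ⟩
    (δV (bv i t) z + (1ℤ - 0ℤ) * δV bL z) + - 1ℤ * (δV bL z + (1ℤ - 1ℤ) * δV bL z)
      ≡⟨ cancel (δV (bv i t) z) (δV bL z) ⟩
    δV (bv i t) z
      ≡⟨ trans (δV*divisor (bv i t) z) (trans (cong (λ n → δV (bv i t) z * + n) (divisor-≢last i t t≢last))
                                              (ℤP.*-identityʳ _)) ⟨
    δV (bv i t) z * + divisor z
      ≡⟨ cong (_* + divisor z) (trans (cong (λ x → δV (bv i t) z + x) (trans (cong (_* R) (δ-≢ t≢last)) (ℤP.*-zeroˡ R)))
                                      (ℤP.+-identityʳ (δV (bv i t) z))) ⟨
    (δV (bv i t) z + NT (bv i t) z) * + divisor z ∎
    where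
    L = last i
    bL = bv i L
    R = δV (av i zero) z + sumℤ (λ t′ → ((1ℤ - δ zero t′) * (1ℤ - δ t′ L)) * δV (bv i t′) z)
    cancel : ∀ a b → (a + (1ℤ - 0ℤ) * b) + - 1ℤ * (b + (1ℤ - 1ℤ) * b) ≡ a
    cancel = solve-∀

  reducedRow-timesQ-bv-last : ∀ i z →
    timesQ (reducedRow (bv i (last i))) z ≡ (δV (bv i (last i)) z + NT (bv i (last i)) z) * + divisor z
  reducedRow-timesQ-bv-last i z = begin
    timesQ (reducedRow bL) z
      ≡⟨ timesQ-cong (λ y → trans (reducedRow-bv-last i y) (closed-av-expand i zero y)) z ⟩
    timesQ (λ y → δV a₀ y + sumℤ (λ t → c t * δV (bv i t) y)) z
      ≡⟨ timesQ-+ (δV a₀) (λ y → sumℤ (λ t → c t * δV (bv i t) y)) z ⟩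
    timesQ (δV a₀) z + timesQ (λ y → sumℤ (λ t → c t * δV (bv i t) y)) z
      ≡⟨ cong₂ _+_ (trans (timesQ-δV a₀ z) (cong (λ x → δV a₀ z + x) (NQ-av i zero z)))
                   (trans (timesQ-combination c (bv i) z)
                          (sumℤ-cong (λ t → cong (λ x → c t * (X t + x)) (NQ-bv i t z)))) ⟩
    (δV a₀ z + - X L) + sumℤ (λ t → c t * (X t + (1ℤ - δ t L) * X L))
      ≡⟨ cong (λ x → (δV a₀ z + - X L) + x)
              (trans (sumℤ-cong (λ t → distrib (c t) (X t) (1ℤ - δ t L) (X L)))
                     (sumℤ-+ (λ t → c t * X t) (λ t → w t * X L))) ⟩
    (δV a₀ z + - X L) + (sumℤ (λ t → c t * X t) + sumℤ (λ t → w t * X L))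
      ≡⟨ cong₂ (λ a b → (δV a₀ z + - X L) + (a + b)) split (trans (sumℤ-*ʳ (X L) w) (cong (_* X L) count)) ⟩
    (δV a₀ z + - X L) + ((sumℤ (λ t → w t * X t) + X L) + + d i * X L)
      ≡⟨ regroup (δV a₀ z) (X L) (sumℤ (λ t → w t * X t)) (+ d i) ⟩
    X L * + d i + (δV a₀ z + sumℤ (λ t → w t * X t))
      ≡⟨ cong₂ _+_ (trans (δV*divisor bL z) (cong (λ n → X L * + n) (divisor-last i)))
                   (trans (NT*divisor i z) NT-last) ⟨
    X L * + divisor z + NT bL z * + divisor z
      ≡⟨ ℤP.*-distribʳ-+ (+ divisor z) (X L) (NT bL z) ⟨
    (X L + NT bL z) * + divisor z ∎
    where
    L = last i
    a₀ = av i zero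
    bL = bv i L
    c w X : Fin (suc (suc (d i))) → ℤ
    c t = 1ℤ - δ zero t
    w t = c t * (1ℤ - δ t L)
    X t = δV (bv i t) z

    NT-last : NT bL z ≡ δV a₀ z + sumℤ (λ t → w t * X t)
    NT-last = trans (cong (_* (δV a₀ z + sumℤ (λ t → w t * X t))) (δ-refl L)) (ℤP.*-identityˡ _)

    split : sumℤ (λ t → c t * X t) ≡ sumℤ (λ t → w t * X t) + X L
    split = trans (sumℤ-drop L (λ t → c t * X t))
                  (cong₂ _+_ (sumℤ-cong (λ t → reassoc (1ℤ - δ t L) (c t) (X t))) (ℤP.*-identityˡ (X L)))
      where reassoc : ∀ e a x → e * (a * x) ≡ (a * e) * x
            reassoc = solve-∀

    count : sumℤ w ≡ + d i
    count = trans (sumℤ-cong (λ t → cong (λ e → c t * (1ℤ - e)) (δ-sym t L))) (sumℤ-[1-δ][1-δ] zero L)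

    distrib : ∀ a x e b → a * (x + e * b) ≡ a * x + (a * e) * b
    distrib = solve-∀
    regroup : ∀ a b s n → (a + - b) + ((s + b) + n * b) ≡ b * n + (a + s)
    regroup = solve-∀

  reducedRow-timesQ : ∀ x z → timesQ (reducedRow x) z ≡ (δV x z + NT x z) * + divisor z
  reducedRow-timesQ apex     z = reducedRow-timesQ-apex z
  reducedRow-timesQ (twin t) z = reducedRow-timesQ-twin t z
  reducedRow-timesQ (av i s) z = reducedRow-timesQ-av i s z
  reducedRow-timesQ (bv i t) z = by-position (t F.≟ last i)
    where
    by-position : Dec (t ≡ last i) → timesQ (reducedRow (bv i t)) z ≡ (δV (bv i t) z + NT (bv i t) z) * + divisor z
    by-position (yes refl)  = reducedRow-timesQ-bv-last i z
    by-position (no t≢last) = reducedRow-timesQ-bv≢last i t z t≢last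

  data Side (i : Fin K) : Set where
    onA onB : Fin (suc (suc (d i))) → Side i
    off     : Side i

  traceA traceB : ∀ {i} → Side i → Fin (suc (suc (d i))) → ℤ
  traceA (onA p) s = δ p s
  traceA (onB q) s = 1ℤ - δ q s
  traceA off     s = 0ℤ
  traceB (onA p) t = 1ℤ - δ p t
  traceB (onB q) t = δ q t
  traceB off     t = 0ℤ

  side : ∀ u i → Σ (Side i) λ σ → (∀ s → ι (closedV u (av i s)) ≡ traceA σ s)
                                × (∀ t → ι (closedV u (bv i t)) ≡ traceB σ t)
  side apex     i = off , (λ _ → refl) , (λ _ → refl)
  side (twin _) i = off , (λ _ → refl) , (λ _ → refl)
  side (av i′ p) i = by-component (i′ F.≟ i)
    where
    by-component : Dec (i′ ≡ i) → Σ (Side i) λ σ → (∀ s → ι (closedV (av i′ p) (av i s)) ≡ traceA σ s)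
                                                  × (∀ t → ι (closedV (av i′ p) (bv i t)) ≡ traceB σ t)
    by-component (yes refl) = onA p , closed-av-av i p , closed-av-bv i p
    by-component (no i′≢i)  = off , (λ s → closed-av-av≢ p s i′≢i) , (λ t → closed-av-bv≢ p t i′≢i)
  side (bv i′ q) i = by-component (i′ F.≟ i)
    where
    by-component : Dec (i′ ≡ i) → Σ (Side i) λ σ → (∀ s → ι (closedV (bv i′ q) (av i s)) ≡ traceA σ s)
                                                  × (∀ t → ι (closedV (bv i′ q) (bv i t)) ≡ traceB σ t)
    by-component (yes refl) = onB q , (λ s → trans (closed-bv-av i q s) (cong (λ e → 1ℤ - e) (δ-sym s q)))
                                    , closed-bv-bv i q
    by-component (no i′≢i)  = off , (λ s → closed-bv-av≢ q s i′≢i) , (λ t → closed-bv-bv≢ q t i′≢i)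

  -- |N[u] ∩ N[v] ∩ Bᵢ| − |N[u] ∩ N[v] ∩ Aᵢ| ≡ 0 (mod dᵢ); a crown side has dᵢ + 2 vertices.
  trace-difference-divisible : ∀ {i} (σ τ : Side i) → Σ ℤ λ y →
    sumℤ (λ t → traceB σ t * traceB τ t) + - sumℤ (λ s → traceA σ s * traceA τ s) ≡ y * + d i
  trace-difference-divisible {i} (onA p) (onA q) =
    1ℤ , trans (cong₂ (λ a b → a + - b) (sumℤ-[1-δ][1-δ] p q) (sumℤ-δδ p q)) (count (+ d i) (δ p q))
    where count : ∀ n x → (((1ℤ + (1ℤ + n)) - 1ℤ) - (1ℤ - x)) + - x ≡ 1ℤ * n
          count = solve-∀
  trace-difference-divisible {i} (onB p) (onB q) =
    - 1ℤ , trans (cong₂ (λ a b → a + - b) (sumℤ-δδ p q) (sumℤ-[1-δ][1-δ] p q)) (count (+ d i) (δ p q))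
    where count : ∀ n x → x + - (((1ℤ + (1ℤ + n)) - 1ℤ) - (1ℤ - x)) ≡ - 1ℤ * n
          count = solve-∀
  trace-difference-divisible (onA p) (onB q) =
    0ℤ , trans (cong₂ (λ a b → a + - b) (sumℤ-[1-δ]δ p q) (sumℤ-δˡ p (λ s → 1ℤ - δ q s)))
               (trans (cong (λ e → (1ℤ - δ p q) + - (1ℤ - e)) (δ-sym q p)) (ℤP.+-inverseʳ (1ℤ - δ p q)))
  trace-difference-divisible (onB p) (onA q) =
    0ℤ , trans (cong₂ (λ a b → a + - b) (sumℤ-δˡ p (λ t → 1ℤ - δ q t)) (sumℤ-[1-δ]δ p q))
               (trans (cong (λ e → (1ℤ - e) + - (1ℤ - δ p q)) (δ-sym q p)) (ℤP.+-inverseʳ (1ℤ - δ p q)))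
  trace-difference-divisible {i} off τ =
    0ℤ , cong₂ (λ a b → a + - b) (sumℤ-zero {suc (suc (d i))} (λ _ → refl)) (sumℤ-zero {suc (suc (d i))} (λ _ → refl))
  trace-difference-divisible (onA p) off =
    0ℤ , cong₂ (λ a b → a + - b) (sumℤ-*0 (λ t → 1ℤ - δ p t)) (sumℤ-*0 (δ p))
  trace-difference-divisible (onB q) off =
    0ℤ , cong₂ (λ a b → a + - b) (sumℤ-*0 (δ q)) (sumℤ-*0 (λ s → 1ℤ - δ q s))

  meetRow-timesQ-divisible : ∀ u v z → Σ ℤ λ y → timesQ (meetRow u v) z ≡ y * + divisor z
  meetRow-timesQ-divisible u v apex = meetRow u v apex , trans (timesQ-apex (meetRow u v)) (sym (ℤP.*-identityʳ _))
  meetRow-timesQ-divisible u v (av i s) =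
    meetRow u v (av i s) , trans (timesQ-av (meetRow u v) i s) (sym (ℤP.*-identityʳ _))
  meetRow-timesQ-divisible u v (twin t) = 0ℤ , (begin
    timesQ (meetRow u v) (twin t)                 ≡⟨ timesQ-twin (meetRow u v) t ⟩
    ι (closedV u (twin t) ∧ closedV v (twin t)) - meetRow u v apex
      ≡⟨ cong₂ (λ a b → ι (a ∧ b) - meetRow u v apex) (closed-twin u t) (closed-twin v t) ⟩
    meetRow u v apex - meetRow u v apex           ≡⟨ ℤP.+-inverseʳ (meetRow u v apex) ⟩
    0ℤ ∎)
  meetRow-timesQ-divisible u v (bv i t) = by-position (t F.≟ last i)
    where
    L = last i
    g = meetRow u v
    by-position : Dec (t ≡ L) → Σ ℤ λ y → timesQ g (bv i t) ≡ y * + divisor (bv i t)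
    by-position (no t≢last) = g (bv i t) , (begin
      timesQ g (bv i t)                       ≡⟨ timesQ-bv g i t ⟩
      g (bv i t) + δ t L * collect i g        ≡⟨ cong (λ e → g (bv i t) + e * collect i g) (δ-≢ t≢last) ⟩
      g (bv i t) + 0ℤ                         ≡⟨ ℤP.+-identityʳ _ ⟩
      g (bv i t)                              ≡⟨ ℤP.*-identityʳ _ ⟨
      g (bv i t) * 1ℤ                         ≡⟨ cong (λ n → g (bv i t) * + n) (divisor-≢last i t t≢last) ⟨
      g (bv i t) * + divisor (bv i t) ∎)
    by-position (yes refl) with side u i | side v i
    ... | σ , σA , σB | τ , τA , τB = proj₁ (trace-difference-divisible σ τ) , (begin
      timesQ g (bv i L)
        ≡⟨ timesQ-bv g i L ⟩
      g (bv i L) + δ L L * collect i g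
        ≡⟨ cong (λ e → g (bv i L) + e * collect i g) (δ-refl L) ⟩
      g (bv i L) + 1ℤ * (sumℤ (λ s → - 1ℤ * g (av i s)) + sumℤ (λ t → (1ℤ - δ t L) * g (bv i t)))
        ≡⟨ cong (λ x → g (bv i L) + 1ℤ * (x + sumℤ (λ t → (1ℤ - δ t L) * g (bv i t))))
                (trans (sumℤ-cong (λ s → ℤP.-1*i≡-i (g (av i s)))) (sumℤ-neg (λ s → g (av i s)))) ⟩
      g (bv i L) + 1ℤ * (- sumℤ (λ s → g (av i s)) + sumℤ (λ t → (1ℤ - δ t L) * g (bv i t)))
        ≡⟨ regroup (g (bv i L)) (sumℤ (λ s → g (av i s))) (sumℤ (λ t → (1ℤ - δ t L) * g (bv i t))) ⟩
      (sumℤ (λ t → (1ℤ - δ t L) * g (bv i t)) + g (bv i L)) + - sumℤ (λ s → g (av i s))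
        ≡⟨ cong (λ x → x + - sumℤ (λ s → g (av i s))) (sumℤ-drop L (λ t → g (bv i t))) ⟨
      sumℤ (λ t → g (bv i t)) + - sumℤ (λ s → g (av i s))
        ≡⟨ cong₂ (λ a b → a + - b)
             (sumℤ-cong (λ t → trans (ι-∧ (closedV u (bv i t)) (closedV v (bv i t))) (cong₂ _*_ (σB t) (τB t))))
             (sumℤ-cong (λ s → trans (ι-∧ (closedV u (av i s)) (closedV v (av i s))) (cong₂ _*_ (σA s) (τA s)))) ⟩
      sumℤ (λ t → traceB σ t * traceB τ t) + - sumℤ (λ s → traceA σ s * traceA τ s)
        ≡⟨ proj₂ (trace-difference-divisible σ τ) ⟩
      proj₁ (trace-difference-divisible σ τ) * + d i
        ≡⟨ cong (λ n → proj₁ (trace-difference-divisible σ τ) * + n) (divisor-last i) ⟨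
      proj₁ (trace-difference-divisible σ τ) * + divisor (bv i L) ∎)
      where regroup : ∀ a b c → a + 1ℤ * (- b + c) ≡ (c + a) + - b
            regroup = solve-∀

  A : Mat m m
  A v = RA Γ (v ↑ˡ (m ℕ.* m))

  B : Mat (m ℕ.* m) m
  B p = RA Γ (m ↑ʳ p)

  A≡closedV : ∀ v w → A v w ≡ ι (closedV (vertex v) (vertex w))
  A≡closedV v w rewrite splitAt-↑ˡ m v (m ℕ.* m) = cong ι (closedNbhd-vertex v w)

  B≡meetRow : ∀ p w → B p w ≡ meetRow (vertex (proj₁ (F.remQuot {m} m p))) (vertex (proj₂ (F.remQuot {m} m p))) (vertex w)
  B≡meetRow p w = trans (RA-meet p) (cong₂ (λ a b → ι (a ∧ b)) (closedNbhd-vertex u w) (closedNbhd-vertex v w))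
    where
    u = proj₁ (F.remQuot {m} m p)
    v = proj₂ (F.remQuot {m} m p)
    RA-meet : ∀ p → B p w ≡ ι (closedNbhd Γ (proj₁ (F.remQuot {m} m p)) w ∧ closedNbhd Γ (proj₂ (F.remQuot {m} m p)) w)
    RA-meet p rewrite splitAt-↑ʳ m (m ℕ.* m) p with F.remQuot {m} m p
    ... | _ , _ = refl

  B-combine : ∀ u v w → B (F.combine u v) w ≡ meetRow (vertex u) (vertex v) (vertex w)
  B-combine u v w = trans (B≡meetRow (F.combine u v) w)
    (cong (λ uv → meetRow (vertex (proj₁ uv)) (vertex (proj₂ uv)) (vertex w)) (FP.remQuot-combine u v))

  rowCombination : List (ℤ × Vertex × Vertex) → Fin (m ℕ.* m) → ℤ
  rowCombination []                p = 0ℤ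
  rowCombination ((c , x , y) ∷ l) p = c * δ (F.combine (index x) (index y)) p + rowCombination l p

  rowCombination-·B : ∀ l w → sumℤ (λ p → rowCombination l p * B p w) ≡ combineRows l (vertex w)
  rowCombination-·B []                w = sumℤ-zero {m ℕ.* m} (λ p → refl)
  rowCombination-·B ((c , x , y) ∷ l) w = begin
    sumℤ (λ p → (c * δ xy p + rowCombination l p) * B p w)
      ≡⟨ sumℤ-cong (λ p → ℤP.*-distribʳ-+ (B p w) (c * δ xy p) (rowCombination l p)) ⟩
    sumℤ (λ p → c * δ xy p * B p w + rowCombination l p * B p w)
      ≡⟨ sumℤ-+ (λ p → c * δ xy p * B p w) (λ p → rowCombination l p * B p w) ⟩
    sumℤ (λ p → c * δ xy p * B p w) + sumℤ (λ p → rowCombination l p * B p w)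
      ≡⟨ cong₂ _+_ (trans (sumℤ-cong (λ p → ℤP.*-assoc c (δ xy p) (B p w)))
                          (trans (sumℤ-*ˡ c (λ p → δ xy p * B p w)) (cong (c *_) (sumℤ-δˡ xy (λ p → B p w)))))
                   (rowCombination-·B l w) ⟩
    c * B xy w + combineRows l (vertex w)
      ≡⟨ cong (λ x → c * x + combineRows l (vertex w))
              (trans (B-combine (index x) (index y) w) (cong₂ (λ a b → meetRow a b (vertex w)) (vertex-index x) (vertex-index y))) ⟩
    c * meetRow x y (vertex w) + combineRows l (vertex w) ∎
    where xy = F.combine (index x) (index y)

  X : Mat m (m ℕ.* m)
  X v p = rowCombination (reduction (vertex v)) p + - δ (F.combine v v) p

  A⊕X·B≡reducedRow : ∀ v w → (A ⊕ X · B) v w ≡ reducedRow (vertex v) (vertex w)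
  A⊕X·B≡reducedRow v w = begin
    A v w + sumℤ (λ p → (rowCombination (reduction (vertex v)) p + - δ vv p) * B p w)
      ≡⟨ cong (λ x → A v w + x)
           (trans (sumℤ-cong (λ p → ℤP.*-distribʳ-+ (B p w) (rowCombination (reduction (vertex v)) p) (- δ vv p)))
           (trans (sumℤ-+ (λ p → rowCombination (reduction (vertex v)) p * B p w) (λ p → - δ vv p * B p w))
                  (cong₂ _+_ (rowCombination-·B (reduction (vertex v)) w)
                     (trans (sumℤ-cong (λ p → sym (ℤP.neg-distribˡ-* (δ vv p) (B p w))))
                     (trans (sumℤ-neg (λ p → δ vv p * B p w)) (cong -_ (sumℤ-δˡ vv (λ p → B p w)))))))) ⟩
    A v w + (reducedRow (vertex v) (vertex w) + - B vv w)
      ≡⟨ cong₂ (λ a b → a + (reducedRow (vertex v) (vertex w) + - b))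
               (A≡closedV v w) (trans (B-combine v v w) (cong ι (∧-idem (closedV (vertex v) (vertex w))))) ⟩
    ι (closedV (vertex v) (vertex w)) + (reducedRow (vertex v) (vertex w) + - ι (closedV (vertex v) (vertex w)))
      ≡⟨ cancel (ι (closedV (vertex v) (vertex w))) (reducedRow (vertex v) (vertex w)) ⟩
    reducedRow (vertex v) (vertex w) ∎
    where
    vv = F.combine v v
    cancel : ∀ a b → a + (b + - a) ≡ b
    cancel = solve-∀

  NTₘ NQₘ : Mat m m
  NTₘ v w = NT (vertex v) (vertex w)
  NQₘ v w = NQ (vertex v) (vertex w)

  e : Fin m → ℕ
  e = divisor ∘ vertex

  ·I⊕NQₘ≡timesQ : ∀ (G : Fin m → ℤ) (g : Vertex → ℤ) → (∀ w → G w ≡ g (vertex w)) → ∀ k →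
    sumℤ (λ w → G w * (I ⊕ NQₘ) w k) ≡ timesQ g (vertex k)
  ·I⊕NQₘ≡timesQ G g G≡g k = begin
    sumℤ (λ w → G w * (δ w k + NQₘ w k))
      ≡⟨ sumℤ-cong (λ w → trans (cong (_* (δ w k + NQₘ w k)) (G≡g w)) (ℤP.*-distribˡ-+ (g (vertex w)) (δ w k) (NQₘ w k))) ⟩
    sumℤ (λ w → g (vertex w) * δ w k + g (vertex w) * NQₘ w k)
      ≡⟨ sumℤ-+ (λ w → g (vertex w) * δ w k) (λ w → g (vertex w) * NQₘ w k) ⟩
    sumℤ (λ w → g (vertex w) * δ w k) + sumℤ (λ w → g (vertex w) * NQₘ w k)
      ≡⟨ cong (λ x → x + sumℤ (λ w → g (vertex w) * NQₘ w k)) (sumℤ-δʳ k (g ∘ vertex)) ⟩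
    timesQ g (vertex k) ∎

  reduced-·Q : (A ⊕ X · B) · (I ⊕ NQₘ) ≈ (I ⊕ NTₘ) · diag e
  reduced-·Q v k = begin
    ((A ⊕ X · B) · (I ⊕ NQₘ)) v k
      ≡⟨ ·I⊕NQₘ≡timesQ ((A ⊕ X · B) v) (reducedRow (vertex v)) (A⊕X·B≡reducedRow v) k ⟩
    timesQ (reducedRow (vertex v)) (vertex k)
      ≡⟨ reducedRow-timesQ (vertex v) (vertex k) ⟩
    (δV (vertex v) (vertex k) + NTₘ v k) * + e k
      ≡⟨ cong (λ x → (x + NTₘ v k) * + e k) (δV-vertex v k) ⟩
    (I ⊕ NTₘ) v k * + e k
      ≡⟨ ·-diag (I ⊕ NTₘ) e v k ⟨
    ((I ⊕ NTₘ) · diag e) v k ∎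

  B·Q-divisible : ∀ p k → Σ ℤ λ y → (B · (I ⊕ NQₘ)) p k ≡ y * + e k
  B·Q-divisible p k = proj₁ divisible , trans (·I⊕NQₘ≡timesQ (B p) (meetRow u v) (B≡meetRow p) k) (proj₂ divisible)
    where
    u = vertex (proj₁ (F.remQuot {m} m p))
    v = vertex (proj₂ (F.remQuot {m} m p))
    divisible = meetRow-timesQ-divisible u v (vertex k)

  RA-diagonalisation : Σ (Mat (m ℕ.+ m ℕ.* m) (m ℕ.+ m ℕ.* m)) λ P → Σ (Mat m m) λ Q →
    Unimodular P × Unimodular Q × (∀ i j → (P · RA Γ · Q) i j ≡ diagRect e i j)
  RA-diagonalisation = diagonalisation (RA Γ) X NTₘ NQₘ e
    (λ i j → sumℤ-zero (λ l → NT-square-zero (vertex i) (vertex l) (vertex j)))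
    (λ i j → sumℤ-zero (λ l → NQ-square-zero (vertex i) (vertex l) (vertex j)))
    reduced-·Q B·Q-divisible

  e≗smithDiagonal : ∀ w → e w ≡ smithDiagonal (suc O) r d w
  e≗smithDiagonal zero    = refl
  e≗smithDiagonal (suc w) = body (splitAt O w)
    where
    piece : ∀ o → divisor (vertexOfPiece (toPiece K d o)) ≡ 1
    piece o with toPiece K d o
    ... | i , inj₁ s = refl
    ... | i , inj₂ t = divisor-≢last i (inject₁ t) (FP.fromℕ≢inject₁ ∘ sym)
    tail : ∀ s → divisor (vertexOfTail s) ≡ [ d , Vector.replicate r 0 ] s
    tail (inj₁ i) = divisor-last i
    tail (inj₂ t) = refl
    body : ∀ s → divisor (vertexOfBody s)
                 ≡ [ Vector.replicate (suc O) 1 , d Vector.++ Vector.replicate r 0 ] (map₁ suc s)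
    body (inj₁ o) = piece o
    body (inj₂ w) = tail (splitAt K w)

  e-chain : (∀ (i : Fin k) → d (inject₁ i) ∣ d (suc i)) → Chain e
  e-chain d∣d = chain-≗ e≗smithDiagonal
    (chain-++ (chain-replicate (suc O) 1)
              (chain-++ (chain-inject₁ d d∣d) (chain-replicate r 0) (λ i _ → d i ℕD.∣0))
              (λ _ _ → ℕD.1∣ _))

  toList-e : toList e ≡ toList (smithDiagonal (suc O) r d)
  toList-e = ListP.tabulate-cong e≗smithDiagonal

mainTheorem1 : (k : ℕ) (d : Fin (suc k) → ℕ) (r : ℕ)
    → (∀ i → 0 < d i)
    → (∀ (i : Fin k) → d (inject₁ i) ∣ d (suc i))
    → 2 ≤ d zero
    → Σ ℕ λ m → Σ (Graph m) λ Γ → Σ (Fin m → ℕ) λ e →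
        IsSmithNormalForm (RA Γ) e
        × numZeros e ≡ r
        × nontrivialDivisors e ≡ toList d
mainTheorem1 k d r d>0 d∣d 2≤d₀ =
  m , Γ , e , (e-chain d∣d , RA-diagonalisation) ,
  trans (cong (length ∘ filterᵇ isZero) toList-e) (numZeros-smithDiagonal (suc O) r d d>0) ,
  trans (cong (filterᵇ isNontrivial) toList-e)
        (nontrivialDivisors-smithDiagonal (suc O) r d (λ i → ℕP.≤-trans 2≤d₀ (head≤ d d>0 d∣d i)))
  where open Construction k d r d>0
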